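{- Let $n\ge2$ and let $\mathscr{A}$ be a closed set of games such that $\mathcal{Q}(\mathscr{A})$ is faithful and is identified with $\mathcal{T}_n$ in such a way that every $X\in\mathscr{A}$ with $\Phi(X)=z_i$ has Grundy value $i$. Let $G\ne0$ be a game all of whose options lie in $\mathscr{A}$, $m=\mathscr{G}(G)$, $\mathscr{B}=\mathrm{cl}(\mathscr{A}\cup\{G\})$ with quotient map $\Phi_\mathscr{B}$, and $\Delta=\Phi''G\cap\{1,a,z,az\}$. Assume $\Phi''G$ is tame. If $m<2^n$, there is an isomorphism $\psi:\mathcal{Q}(\mathscr{B})\to\mathcal{T}_n$; if $m=2^n$, there is an isomorphism $\psi:\mathcal{Q}(\mathscr{B})\to\mathcal{T}_{n+1}$; in either case $\psi(\Phi_\mathscr{B}(Y))=\Phi(Y)$ for all $Y\in\mathscr{A}$ (regarding $\mathcal{T}_n\subseteq\mathcal{T}_{n+1}$ via the same names $1,a,z_i$), and $\psi(\Phi_\mathscr{B}(G))=1$ if $\Delta=\{a\}$, $\psi(\Phi_\mathscr{B}(G))=a$ if $\Delta=\{1\}$, and $\psi(\Phi_\mathscr{B}(G))=z_m$ otherwise.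
   Context: Impartial games: a game is the set of its options; $0=\emptyset$; $G+H$ has options $G'+H$, $G+H'$. Misère play: $G$ is a $\mathscr{P}$-position iff $G\ne0$ and every option is an $\mathscr{N}$-position. A set of games is closed if it contains $0$ and is closed under options and sums; $\mathrm{cl}(\mathscr{S})$ is the smallest closed set containing $\mathscr{S}$. For closed $\mathscr{A}$, $G\equiv_\mathscr{A}H$ iff $G+X$, $H+X$ have the same misère outcome for all $X\in\mathscr{A}$; $\mathcal{Q}(\mathscr{A})=\mathscr{A}/{\equiv_\mathscr{A}}$ with distinguished subset the classes of $\mathscr{P}$-positions, $\Phi$ the quotient map of $\mathscr{A}$; $\Phi''G=\{\Phi(G'):G'$ an option of $G\}$. Isomorphisms preserve distinguished subsets. $\mathscr{G}$ = Grundy value; faithful means $\Phi(X)=\Phi(Y)\Rightarrow\mathscr{G}(X)=\mathscr{G}(Y)$. $\mathcal{T}_k$ ($k\ge2$) has distinct elements $1,a,z_0,\ldots,z_{2^k-1}$, identity $1$, $a^2=1$, $z_iz_j=z_{i\oplus j}$, $az_i=z_{i\oplus1}$ ($\oplus$ bitwise XOR), distinguished subset $\{a,z_0\}$. Write $z=z_0$, $az=z_1$. For $\mathcal{E}\subseteq\mathcal{T}_n$ with discriminant $\Delta=\mathcal{E}\cap\{1,a,z,az\}$: $\mathcal{E}$ is restive if $\Delta=\{1,z\}$ or $\{a,az\}$, restless if $\Delta=\{a,z\}$ or $\{1,az\}$, and tame otherwise. -}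

module Defs where

open import Data.Nat using (ℕ; zero; suc; _+_; _*_; _^_; _<_)
open import Data.Bool using (Bool; true; false; not; _∧_; _xor_; if_then_else_)
open import Data.List using (List; []; _∷_; _++_)
open import Data.List.Membership.Propositional using (_∈_)
open import Data.List.Relation.Unary.Any using (Any)
open import Data.Vec using (Vec; []; _∷_; zipWith; replicate; _∷ʳ_)
open import Data.Product using (Σ; _×_; _,_; ∃)
open import Data.Sum using (_⊎_)
open import Relation.Binary.PropositionalEquality using (_≡_)
open import Relation.Nullary using (¬_)

data Game : Set where
  mk : List Game → Game

options : Game → List Game
options (mk gs) = gs

𝟘 : Game
𝟘 = mk []

_isOptionOf_ : Game → Game → Set
G′ isOptionOf G = G′ ∈ options G

mutual
  _⊕_ : Game → Game → Game
  mk gs ⊕ mk hs = mk (lefts gs hs ++ rights gs hs)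

  lefts : List Game → List Game → List Game
  lefts [] hs = []
  lefts (g ∷ gs) hs = (g ⊕ mk hs) ∷ lefts gs hs

  rights : List Game → List Game → List Game
  rights gs [] = []
  rights gs (h ∷ hs) = (mk gs ⊕ h) ∷ rights gs hs

-- Misère outcome: G is a P-position iff G ≠ 0 and every option is an N-position.
mutual
  isP : Game → Bool
  isP (mk []) = false
  isP (mk (g ∷ gs)) = allN (g ∷ gs)

  allN : List Game → Bool
  allN [] = true
  allN (g ∷ gs) = not (isP g) ∧ allN gs

_∈ᵇ_ : ℕ → List ℕ → Bool
n ∈ᵇ [] = false
n ∈ᵇ (m ∷ ms) = if eqᵇ n m then true else (n ∈ᵇ ms)
  where
  eqᵇ : ℕ → ℕ → Bool
  eqᵇ zero zero = true
  eqᵇ zero (suc _) = false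
  eqᵇ (suc _) zero = false
  eqᵇ (suc a) (suc b) = eqᵇ a b

mexSearch : List ℕ → ℕ → ℕ → ℕ
mexSearch l zero k = k
mexSearch l (suc f) k = if k ∈ᵇ l then mexSearch l f (suc k) else k

lengthℕ : List ℕ → ℕ
lengthℕ [] = 0
lengthℕ (_ ∷ l) = suc (lengthℕ l)

-- mex l = least natural number not in l (it is ≤ length l, so fuel length l suffices)
mex : List ℕ → ℕ
mex l = mexSearch l (lengthℕ l) 0

mutual
  grundy : Game → ℕ
  grundy (mk gs) = mex (grundyList gs)

  grundyList : List Game → List ℕ
  grundyList [] = []
  grundyList (g ∷ gs) = grundy g ∷ grundyList gs

GameSet : Set₁
GameSet = Game → Set

record Closed (𝒜 : GameSet) : Set where
  field
    has-zero : 𝒜 𝟘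
    opt-closed : ∀ {G G′} → 𝒜 G → G′ isOptionOf G → 𝒜 G′
    sum-closed : ∀ {G H} → 𝒜 G → 𝒜 H → 𝒜 (G ⊕ H)

data cl (𝒮 : GameSet) : GameSet where
  base : ∀ {G} → 𝒮 G → cl 𝒮 G
  zero∈ : cl 𝒮 𝟘
  opt∈ : ∀ {G G′} → cl 𝒮 G → G′ isOptionOf G → cl 𝒮 G′
  sum∈ : ∀ {G H} → cl 𝒮 G → cl 𝒮 H → cl 𝒮 (G ⊕ H)

_≡[_]_ : Game → GameSet → Game → Set
G ≡[ 𝒜 ] H = ∀ X → 𝒜 X → isP (G ⊕ X) ≡ isP (H ⊕ X)

-- The monoid 𝒯_k.  The index i ∈ {0,…,2^k-1} of z_i is represented by its
-- k-bit binary expansion (little-endian), so that ⊕ (bitwise XOR) is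
-- pointwise xor; `val` recovers the natural number i.

Bits : ℕ → Set
Bits k = Vec Bool k

val : ∀ {k} → Bits k → ℕ
val [] = 0
val (b ∷ v) = (if b then 1 else 0) + 2 * val v

data 𝒯 (k : ℕ) : Set where
  one : 𝒯 k
  a   : 𝒯 k
  z   : Bits k → 𝒯 k

flip0 : ∀ {k} → Bits k → Bits k
flip0 [] = []
flip0 (b ∷ v) = not b ∷ v

_·_ : ∀ {k} → 𝒯 k → 𝒯 k → 𝒯 k
one · y = y
a · one = a
a · a = one
a · z j = z (flip0 j)
z i · one = z i
z i · a = z (flip0 i)
z i · z j = z (zipWith _xor_ i j)

-- z = z_0 and az = z_1
z₀ : ∀ {k} → 𝒯 k
z₀ = z (replicate _ false)

-- (the index 1 has binary expansion 1,0,…,0; only used for k ≥ 2)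
oneBits : ∀ k → Bits k
oneBits zero = []
oneBits (suc k) = true ∷ replicate k false

z₁ : ∀ {k} → 𝒯 k
z₁ {k} = z (oneBits k)

Dist : ∀ {k} → 𝒯 k → Set
Dist t = t ≡ a ⊎ t ≡ z₀

embed : ∀ {k} → 𝒯 k → 𝒯 (suc k)
embed one = one
embed a = a
embed (z i) = z (i ∷ʳ false)

-- ψ : Game → 𝒯 k represents an isomorphism 𝒬(𝒜) ≅ 𝒯_k: on 𝒜 it is
-- constant exactly on ≡_𝒜-classes (well defined and injective on the
-- quotient), surjective, multiplicative, and maps the classes of
-- P-positions exactly onto the distinguished subset.

record IsQuotientIso (𝒜 : GameSet) {k : ℕ} (ψ : Game → 𝒯 k) : Set where
  field
    well-defined : ∀ {X Y} → 𝒜 X → 𝒜 Y → X ≡[ 𝒜 ] Y → ψ X ≡ ψ Y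
    injective    : ∀ {X Y} → 𝒜 X → 𝒜 Y → ψ X ≡ ψ Y → X ≡[ 𝒜 ] Y
    surjective   : ∀ t → Σ Game (λ X → 𝒜 X × ψ X ≡ t)
    hom-zero     : ψ 𝟘 ≡ one
    hom-sum      : ∀ {X Y} → 𝒜 X → 𝒜 Y → ψ (X ⊕ Y) ≡ ψ X · ψ Y
    dist-to      : ∀ {X} → 𝒜 X → isP X ≡ true → Dist (ψ X)
    dist-from    : ∀ {X} → 𝒜 X → Dist (ψ X) → isP X ≡ true

Faithful : GameSet → ∀ {k} → (Game → 𝒯 k) → Set
Faithful 𝒜 φ = ∀ {X Y} → 𝒜 X → 𝒜 Y → φ X ≡ φ Y → grundy X ≡ grundy Y

_∈Φ''_[_] : ∀ {k} → 𝒯 k → Game → (Game → 𝒯 k) → Set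
t ∈Φ'' G [ φ ] = Any (λ G′ → φ G′ ≡ t) (options G)

InFour : ∀ {k} → 𝒯 k → Set
InFour t = t ≡ one ⊎ t ≡ a ⊎ t ≡ z₀ ⊎ t ≡ z₁

Δ≐ : ∀ {k} → (Game → 𝒯 k) → Game → List (𝒯 k) → Set
Δ≐ φ G S = ∀ t → ((t ∈Φ'' G [ φ ] × InFour t) → t ∈ S) × (t ∈ S → (t ∈Φ'' G [ φ ] × InFour t))

Tame : ∀ {k} → (Game → 𝒯 k) → Game → Set
Tame φ G = ¬ Δ≐ φ G (one ∷ z₀ ∷ []) × ¬ Δ≐ φ G (a ∷ z₁ ∷ [])
         × ¬ Δ≐ φ G (a ∷ z₀ ∷ []) × ¬ Δ≐ φ G (one ∷ z₁ ∷ [])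

-- Every game of ℬ is bisimilar to Y + k·G with Y ∈ 𝒜, and we send it to e(Φ Y)·g^k, where g ∈ {1, a, z_m}
-- is the prescribed image of G and e is the inclusion of 𝒯_n into itself or into 𝒯_(n+1). Induction on games
-- shows that Y + k·G is a P-position exactly when e(Φ Y)·g^k is distinguished; for this it suffices that no move
-- from a distinguished value reaches a distinguished value while some move from any other value does. For moves
-- in Y this follows from Grundy values, which 𝒜 determines; for moves in one copy of G it is checked separately
-- for g = 1 (Δ = {a}), g = a (Δ = {1}) and g = z_m, using tameness for the exceptional moves to 1 and a.
-- Since 𝒯 is reduced, outcomes against one representative of each class then determine a well-defined
-- isomorphism ψ : 𝒬(ℬ) → 𝒯.

module Submission where

open import Defs
open import Data.Nat using (ℕ; zero; suc; pred; _+_; _*_; _^_; _≤_; _<_; s≤s; z≤n; _≡ᵇ_)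
open import Data.Nat.Properties
  using ( <-irrefl; ≤-<-trans; n<1+n; ≤-pred; m≤n⇒m<n∨m≡n; +-suc; +-identityʳ; ≡ᵇ⇒≡; ≡⇒≡ᵇ
        ; *-cancelˡ-≡; *-cancelˡ-<; even≢odd; m≤n+m; <-cmp; n≮0; m^n>0; *-monoʳ-≤ )
open import Data.Bool using (Bool; true; false; not; _∧_; _∨_; _xor_; if_then_else_; T)
open import Data.Bool.Properties
  using ( ⇔→≡; T-∨; T-≡; ¬-not; xor-comm; xor-assoc; xor-identityˡ; xor-identityʳ; xor-same
        ; ∨-comm; ∨-assoc; not-involutive )
  renaming (_≟_ to _≟ᴮ_)
open import Data.Fin using (Fin; toℕ)
open import Data.Fin.Properties using (pigeonhole; toℕ<n)
open import Data.Vec using ([]; _∷_; zipWith; replicate; _∷ʳ_; initLast)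
open import Data.Vec.Properties using (zipWith-comm; zipWith-assoc; zipWith-identityˡ; zipWith-identityʳ)
import Data.Vec.Properties as Vec
open import Data.List using (List; []; _∷_; _++_; map; length; lookup)
open import Data.List.Properties using (map-cong; ∷-injective; ≡-dec)
open import Data.List.Relation.Unary.Any using (here; there; any?)
import Data.List.Relation.Unary.Any as Any
open import Data.List.Relation.Unary.Any.Properties using (lookup-index)
open import Data.List.Relation.Unary.All using (All; []; _∷_; all?)
import Data.List.Relation.Unary.All as All
open import Data.List.Membership.Propositional using (_∈_; _∉_; find; lose)
open import Data.List.Membership.Propositional.Properties using (∈-map⁺; ∈-map⁻; ∈-++⁺ˡ; ∈-++⁺ʳ; ∈-++⁻)
open import Data.Product using (Σ; ∃; ∃₂; _×_; _,_; proj₁; proj₂)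
open import Data.Sum using (_⊎_; inj₁; inj₂)
open import Data.Empty using (⊥; ⊥-elim)
open import Function using (_⇔_; mk⇔; Equivalence; _∘_)
open import Induction.WellFounded using (Acc; acc; WellFounded)
open import Relation.Nullary using (¬_; Dec; yes; no; ¬?)
open import Relation.Nullary.Decidable using (map′; _×-dec_; _⊎-dec_; _→-dec_)
open import Relation.Binary.Definitions using (DecidableEquality; tri<; tri≈; tri>)
open import Relation.Binary.PropositionalEquality using (_≡_; _≢_; _≗_; refl; sym; trans; cong; cong₂; subst)
open Relation.Binary.PropositionalEquality.≡-Reasoning

false≢true : false ≢ true
false≢true ()

-- Games

mutual
  isOptionOf-wellFounded : WellFounded _isOptionOf_
  isOptionOf-wellFounded (mk gs) = acc (∈-accessible gs)

  ∈-accessible : ∀ gs {x} → x ∈ gs → Acc _isOptionOf_ x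
  ∈-accessible (g ∷ gs) (here refl) = isOptionOf-wellFounded g
  ∈-accessible (g ∷ gs) (there p) = ∈-accessible gs p

lefts-map : ∀ gs hs → lefts gs hs ≡ map (_⊕ mk hs) gs
lefts-map [] hs = refl
lefts-map (g ∷ gs) hs = cong (_ ∷_) (lefts-map gs hs)

rights-map : ∀ gs hs → rights gs hs ≡ map (mk gs ⊕_) hs
rights-map gs [] = refl
rights-map gs (h ∷ hs) = cong (_ ∷_) (rights-map gs hs)

⊕-optionˡ : ∀ X Y {X′} → X′ isOptionOf X → (X′ ⊕ Y) isOptionOf (X ⊕ Y)
⊕-optionˡ (mk gs) (mk hs) p rewrite lefts-map gs hs = ∈-++⁺ˡ (∈-map⁺ (_⊕ mk hs) p)

⊕-optionʳ : ∀ X Y {Y′} → Y′ isOptionOf Y → (X ⊕ Y′) isOptionOf (X ⊕ Y)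
⊕-optionʳ (mk gs) (mk hs) p rewrite lefts-map gs hs | rights-map gs hs =
  ∈-++⁺ʳ (map (_⊕ mk hs) gs) (∈-map⁺ (mk gs ⊕_) p)

⊕-option⁻ : ∀ X Y {W} → W isOptionOf (X ⊕ Y)
          → (∃ λ X′ → X′ isOptionOf X × W ≡ X′ ⊕ Y) ⊎ (∃ λ Y′ → Y′ isOptionOf Y × W ≡ X ⊕ Y′)
⊕-option⁻ (mk gs) (mk hs) p rewrite lefts-map gs hs | rights-map gs hs
  with ∈-++⁻ (map (_⊕ mk hs) gs) p
... | inj₁ q = inj₁ (∈-map⁻ (_⊕ mk hs) q)
... | inj₂ q = inj₂ (∈-map⁻ (mk gs ⊕_) q)

mutual
  ⊕-identityʳ : ∀ X → X ⊕ 𝟘 ≡ X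
  ⊕-identityʳ (mk gs) = cong mk (lefts-identityʳ gs)

  lefts-identityʳ : ∀ gs → lefts gs [] ++ [] ≡ gs
  lefts-identityʳ [] = refl
  lefts-identityʳ (g ∷ gs) = cong₂ _∷_ (⊕-identityʳ g) (lefts-identityʳ gs)

allN⇒N : ∀ gs → allN gs ≡ true → ∀ {x} → x ∈ gs → isP x ≡ false
allN⇒N (g ∷ gs) e p with isP g in eq
allN⇒N (g ∷ gs) () p | true
allN⇒N (g ∷ gs) e (here refl) | false = eq
allN⇒N (g ∷ gs) e (there p) | false = allN⇒N gs e p

N⇒allN : ∀ gs → (∀ {x} → x ∈ gs → isP x ≡ false) → allN gs ≡ true
N⇒allN [] h = refl
N⇒allN (g ∷ gs) h rewrite h (here refl) = N⇒allN gs (λ p → h (there p))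

¬allN⇒P : ∀ gs → allN gs ≡ false → ∃ λ x → x ∈ gs × isP x ≡ true
¬allN⇒P (g ∷ gs) e with isP g in eq
... | true = g , here refl , eq
... | false = let (x , p , Px) = ¬allN⇒P gs e in x , there p , Px

P⇒option : ∀ X → isP X ≡ true → ∃ (_isOptionOf X)
P⇒option (mk (g ∷ gs)) _ = g , here refl

P⇒options-N : ∀ X → isP X ≡ true → ∀ {x} → x isOptionOf X → isP x ≡ false
P⇒options-N (mk (g ∷ gs)) e = allN⇒N (g ∷ gs) e

P-intro : ∀ X {x} → x isOptionOf X → (∀ {x′} → x′ isOptionOf X → isP x′ ≡ false) → isP X ≡ true
P-intro (mk (g ∷ gs)) _ h = N⇒allN (g ∷ gs) h

N-intro : ∀ X {x} → x isOptionOf X → isP x ≡ true → isP X ≡ false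
N-intro X p Px with isP X in eq
... | false = refl
... | true with trans (sym Px) (P⇒options-N X eq p)
...   | ()

N-elim : ∀ X → isP X ≡ false → X ≡ 𝟘 ⊎ (∃ λ x → x isOptionOf X × isP x ≡ true)
N-elim (mk []) _ = inj₁ refl
N-elim (mk (g ∷ gs)) e = inj₂ (¬allN⇒P (g ∷ gs) e)

-- Sums are commutative and associative only up to bisimilarity.
infix 4 _≈_
data _≈_ : Game → Game → Set where
  bisim : ∀ {X Y} → (∀ {x} → x isOptionOf X → ∃ λ y → y isOptionOf Y × x ≈ y)
                  → (∀ {y} → y isOptionOf Y → ∃ λ x → x isOptionOf X × x ≈ y)
                  → X ≈ Y

≈-refl : ∀ {X} → X ≈ X
≈-refl = go (isOptionOf-wellFounded _)
  where
  go : ∀ {X} → Acc _isOptionOf_ X → X ≈ X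
  go (acc rs) = bisim (λ p → _ , p , go (rs p)) (λ p → _ , p , go (rs p))

≈-sym : ∀ {X Y} → X ≈ Y → Y ≈ X
≈-sym = go (isOptionOf-wellFounded _)
  where
  go : ∀ {X Y} → Acc _isOptionOf_ X → X ≈ Y → Y ≈ X
  go (acc rs) (bisim fwd bwd) =
    bisim (λ q → let (x , p , x≈y) = bwd q in x , p , go (rs p) x≈y)
          (λ p → let (y , q , x≈y) = fwd p in y , q , go (rs p) x≈y)

≈-trans : ∀ {X Y Z} → X ≈ Y → Y ≈ Z → X ≈ Z
≈-trans = go (isOptionOf-wellFounded _)
  where
  go : ∀ {X Y Z} → Acc _isOptionOf_ X → X ≈ Y → Y ≈ Z → X ≈ Z
  go (acc rs) (bisim fwd bwd) (bisim fwd′ bwd′) =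
    bisim (λ p → let (y , q , x≈y) = fwd p ; (w , r , y≈w) = fwd′ q in w , r , go (rs p) x≈y y≈w)
          (λ r → let (y , q , y≈w) = bwd′ r ; (x , p , x≈y) = bwd q in x , p , go (rs p) x≈y y≈w)

≡⇒≈ : ∀ {X Y} → X ≡ Y → X ≈ Y
≡⇒≈ refl = ≈-refl

isP-resp-≈ : ∀ {X Y} → X ≈ Y → isP X ≡ isP Y
isP-resp-≈ = go (isOptionOf-wellFounded _)
  where
  go : ∀ {X Y} → Acc _isOptionOf_ X → X ≈ Y → isP X ≡ isP Y
  go {X} {Y} (acc rs) (bisim fwd bwd) = ⇔→≡ {z = true} (mk⇔ to from)
    where
    to : isP X ≡ true → isP Y ≡ true
    to PX = let (x , p) = P⇒option X PX ; (y , q , _) = fwd p in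
      P-intro Y q λ q′ → let (x′ , p′ , x′≈y′) = bwd q′ in
        trans (sym (go (rs p′) x′≈y′)) (P⇒options-N X PX p′)
    from : isP Y ≡ true → isP X ≡ true
    from PY = let (y , q) = P⇒option Y PY ; (x , p , _) = bwd q in
      P-intro X p λ p′ → let (y′ , q′ , x′≈y′) = fwd p′ in
        trans (go (rs p′) x′≈y′) (P⇒options-N Y PY q′)

⊕-cong : ∀ {X X′ Y Y′} → X ≈ X′ → Y ≈ Y′ → X ⊕ Y ≈ X′ ⊕ Y′
⊕-cong = go (isOptionOf-wellFounded _)
  where
  go : ∀ {X X′ Y Y′} → Acc _isOptionOf_ (X ⊕ Y) → X ≈ X′ → Y ≈ Y′ → X ⊕ Y ≈ X′ ⊕ Y′
  go {X} {X′} {Y} {Y′} (acc rs) X≈X′@(bisim fX bX) Y≈Y′@(bisim fY bY) = bisim fwd bwd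
    where
    fwd : ∀ {w} → w isOptionOf (X ⊕ Y) → ∃ λ v → v isOptionOf (X′ ⊕ Y′) × w ≈ v
    fwd p with ⊕-option⁻ X Y p
    ... | inj₁ (x , q , refl) = let (x′ , q′ , x≈x′) = fX q in
          x′ ⊕ Y′ , ⊕-optionˡ X′ Y′ q′ , go (rs p) x≈x′ Y≈Y′
    ... | inj₂ (y , q , refl) = let (y′ , q′ , y≈y′) = fY q in
          X′ ⊕ y′ , ⊕-optionʳ X′ Y′ q′ , go (rs p) X≈X′ y≈y′
    bwd : ∀ {v} → v isOptionOf (X′ ⊕ Y′) → ∃ λ w → w isOptionOf (X ⊕ Y) × w ≈ v
    bwd p with ⊕-option⁻ X′ Y′ p
    ... | inj₁ (x′ , q′ , refl) = let (x , q , x≈x′) = bX q′ in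
          x ⊕ Y , ⊕-optionˡ X Y q , go (rs (⊕-optionˡ X Y q)) x≈x′ Y≈Y′
    ... | inj₂ (y′ , q′ , refl) = let (y , q , y≈y′) = bY q′ in
          X ⊕ y , ⊕-optionʳ X Y q , go (rs (⊕-optionʳ X Y q)) X≈X′ y≈y′

⊕-comm : ∀ X Y → X ⊕ Y ≈ Y ⊕ X
⊕-comm X Y = go (isOptionOf-wellFounded (X ⊕ Y))
  where
  go : ∀ {X Y} → Acc _isOptionOf_ (X ⊕ Y) → X ⊕ Y ≈ Y ⊕ X
  go {X} {Y} (acc rs) = bisim fwd bwd
    where
    fwd : ∀ {w} → w isOptionOf (X ⊕ Y) → ∃ λ v → v isOptionOf (Y ⊕ X) × w ≈ v
    fwd p with ⊕-option⁻ X Y p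
    ... | inj₁ (x , q , refl) = Y ⊕ x , ⊕-optionʳ Y X q , go (rs p)
    ... | inj₂ (y , q , refl) = y ⊕ X , ⊕-optionˡ Y X q , go (rs p)
    bwd : ∀ {v} → v isOptionOf (Y ⊕ X) → ∃ λ w → w isOptionOf (X ⊕ Y) × w ≈ v
    bwd p with ⊕-option⁻ Y X p
    ... | inj₁ (y , q , refl) = X ⊕ y , ⊕-optionʳ X Y q , go (rs (⊕-optionʳ X Y q))
    ... | inj₂ (x , q , refl) = x ⊕ Y , ⊕-optionˡ X Y q , go (rs (⊕-optionˡ X Y q))

⊕-assoc : ∀ X Y Z → (X ⊕ Y) ⊕ Z ≈ X ⊕ (Y ⊕ Z)
⊕-assoc X Y Z = go (isOptionOf-wellFounded ((X ⊕ Y) ⊕ Z))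
  where
  go : ∀ {X Y Z} → Acc _isOptionOf_ ((X ⊕ Y) ⊕ Z) → (X ⊕ Y) ⊕ Z ≈ X ⊕ (Y ⊕ Z)
  go {X} {Y} {Z} (acc rs) = bisim fwd bwd
    where
    fwd : ∀ {w} → w isOptionOf ((X ⊕ Y) ⊕ Z) → ∃ λ v → v isOptionOf (X ⊕ (Y ⊕ Z)) × w ≈ v
    fwd p with ⊕-option⁻ (X ⊕ Y) Z p
    ... | inj₂ (z′ , q , refl) = X ⊕ (Y ⊕ z′) , ⊕-optionʳ X (Y ⊕ Z) (⊕-optionʳ Y Z q) , go (rs p)
    ... | inj₁ (u , q , refl) with ⊕-option⁻ X Y q
    ...   | inj₁ (x , s , refl) = x ⊕ (Y ⊕ Z) , ⊕-optionˡ X (Y ⊕ Z) s , go (rs p)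
    ...   | inj₂ (y , s , refl) = X ⊕ (y ⊕ Z) , ⊕-optionʳ X (Y ⊕ Z) (⊕-optionˡ Y Z s) , go (rs p)
    bwd : ∀ {v} → v isOptionOf (X ⊕ (Y ⊕ Z)) → ∃ λ w → w isOptionOf ((X ⊕ Y) ⊕ Z) × w ≈ v
    bwd p with ⊕-option⁻ X (Y ⊕ Z) p
    ... | inj₁ (x , q , refl) = let o = ⊕-optionˡ (X ⊕ Y) Z (⊕-optionˡ X Y q) in (x ⊕ Y) ⊕ Z , o , go (rs o)
    ... | inj₂ (u , q , refl) with ⊕-option⁻ Y Z q
    ...   | inj₁ (y , s , refl) = let o = ⊕-optionˡ (X ⊕ Y) Z (⊕-optionʳ X Y s) in (X ⊕ y) ⊕ Z , o , go (rs o)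
    ...   | inj₂ (z′ , s , refl) = let o = ⊕-optionʳ (X ⊕ Y) Z s in (X ⊕ Y) ⊕ z′ , o , go (rs o)

⊕-identityˡ : ∀ X → 𝟘 ⊕ X ≈ X
⊕-identityˡ X = ≈-trans (⊕-comm 𝟘 X) (≡⇒≈ (⊕-identityʳ X))

⊕-leftComm : ∀ X Y Z → X ⊕ (Y ⊕ Z) ≈ Y ⊕ (X ⊕ Z)
⊕-leftComm X Y Z = ≈-trans (≈-sym (⊕-assoc X Y Z)) (≈-trans (⊕-cong (⊕-comm X Y) ≈-refl) (⊕-assoc Y X Z))

⊕-interchange : ∀ W X Y Z → (W ⊕ X) ⊕ (Y ⊕ Z) ≈ (W ⊕ Y) ⊕ (X ⊕ Z)
⊕-interchange W X Y Z =
  ≈-trans (⊕-assoc W X (Y ⊕ Z)) (≈-trans (⊕-cong ≈-refl (⊕-leftComm X Y Z)) (≈-sym (⊕-assoc W Y (X ⊕ Z))))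

≢𝟘⇒option : ∀ X → X ≢ 𝟘 → ∃ (_isOptionOf X)
≢𝟘⇒option (mk []) X≢𝟘 = ⊥-elim (X≢𝟘 refl)
≢𝟘⇒option (mk (g ∷ gs)) _ = g , here refl

-- Grundy values

∈ᵇ-∷ : ∀ n m ms → n ∈ᵇ (m ∷ ms) ≡ (n ≡ᵇ m) ∨ (n ∈ᵇ ms)
∈ᵇ-∷ zero zero ms = refl
∈ᵇ-∷ zero (suc m) ms = refl
∈ᵇ-∷ (suc n) zero ms = refl
∈ᵇ-∷ (suc n) (suc m) ms = lift (∈ᵇ-∷ n m [])
  where
  -- the local equality test of _∈ᵇ_ does not reduce on variables; compare it with _≡ᵇ_ through the singleton list
  lift : ∀ {b c A} → (if b then true else false) ≡ c ∨ false → (if b then true else A) ≡ c ∨ A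
  lift {true} {true} _ = refl
  lift {false} {false} _ = refl

∈ᵇ⇒∈ : ∀ n ms → n ∈ᵇ ms ≡ true → n ∈ ms
∈ᵇ⇒∈ n (m ∷ ms) e with Equivalence.to T-∨ (Equivalence.from T-≡ (trans (sym (∈ᵇ-∷ n m ms)) e))
... | inj₁ n≡ᵇm = here (≡ᵇ⇒≡ n m n≡ᵇm)
... | inj₂ n∈ᵇms = there (∈ᵇ⇒∈ n ms (Equivalence.to T-≡ n∈ᵇms))

∈⇒∈ᵇ : ∀ n ms → n ∈ ms → n ∈ᵇ ms ≡ true
∈⇒∈ᵇ n (m ∷ ms) p = trans (∈ᵇ-∷ n m ms) (Equivalence.to T-≡ (Equivalence.from T-∨ (cases p)))
  where
  cases : n ∈ (m ∷ ms) → T (n ≡ᵇ m) ⊎ T (n ∈ᵇ ms)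
  cases (here refl) = inj₁ (≡⇒≡ᵇ n n refl)
  cases (there q) = inj₂ (Equivalence.from T-≡ (∈⇒∈ᵇ n ms q))

mexSearch-below : ∀ l f k j → k ≤ j → j < mexSearch l f k → j ∈ᵇ l ≡ true
mexSearch-below l zero k j k≤j j<k = ⊥-elim (<-irrefl refl (≤-<-trans k≤j j<k))
mexSearch-below l (suc f) k j k≤j j< with k ∈ᵇ l in k∈l
... | false = ⊥-elim (<-irrefl refl (≤-<-trans k≤j j<))
... | true with m≤n⇒m<n∨m≡n k≤j
...   | inj₂ refl = k∈l
...   | inj₁ k<j = mexSearch-below l f (suc k) j k<j j<

mexSearch-found : ∀ l f k → mexSearch l f k ∈ᵇ l ≡ true → ∀ j → k ≤ j → j ≤ k + f → j ∈ᵇ l ≡ true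
mexSearch-found l zero k e j k≤j j≤k rewrite +-identityʳ k with m≤n⇒m<n∨m≡n k≤j
... | inj₂ refl = e
... | inj₁ k<j = ⊥-elim (<-irrefl refl (≤-<-trans j≤k k<j))
mexSearch-found l (suc f) k e j k≤j j≤ with k ∈ᵇ l in k∈l
... | false = ⊥-elim (false≢true (trans (sym k∈l) e))
... | true with m≤n⇒m<n∨m≡n k≤j
...   | inj₂ refl = k∈l
...   | inj₁ k<j = mexSearch-found l f (suc k) e j k<j (subst (j ≤_) (+-suc k f) j≤)

lengthℕ≡length : ∀ l → lengthℕ l ≡ length l
lengthℕ≡length [] = refl
lengthℕ≡length (_ ∷ l) = cong suc (lengthℕ≡length l)

range-⊈ : ∀ (l : List ℕ) → ¬ (∀ j → j < suc (length l) → j ∈ l)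
range-⊈ l cover =
  let (i , j , i<j , slot-i≡slot-j) = pigeonhole (n<1+n (length l)) (λ i → Any.index (slot i)) in
  <-irrefl (trans (lookup-index (slot i)) (trans (cong (lookup l) slot-i≡slot-j) (sym (lookup-index (slot j))))) i<j
  where
  slot : (i : Fin (suc (length l))) → toℕ i ∈ l
  slot i = cover (toℕ i) (toℕ<n i)

-- A search that stops at a member of l never failed, so it has found all of 0, …, length l in l.
mex-∉ : ∀ l → mex l ∉ l
mex-∉ l mex∈l = range-⊈ l λ j j≤L → ∈ᵇ⇒∈ j l
  (mexSearch-found l (lengthℕ l) 0 (∈⇒∈ᵇ _ l mex∈l) j z≤n (subst (j ≤_) (sym (lengthℕ≡length l)) (≤-pred j≤L)))

mex-below : ∀ l j → j < mex l → j ∈ l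
mex-below l j j<mex = ∈ᵇ⇒∈ j l (mexSearch-below l (lengthℕ l) 0 j z≤n j<mex)

grundyList≡map : ∀ gs → grundyList gs ≡ map grundy gs
grundyList≡map [] = refl
grundyList≡map (g ∷ gs) = cong (grundy g ∷_) (grundyList≡map gs)

grundy-option≢ : ∀ X {x} → x isOptionOf X → grundy x ≢ grundy X
grundy-option≢ (mk gs) {x} p eq = mex-∉ (grundyList gs)
  (subst (_∈ grundyList gs) eq (subst (grundy x ∈_) (sym (grundyList≡map gs)) (∈-map⁺ grundy p)))

grundy-option-below : ∀ X {j} → j < grundy X → ∃ λ x → x isOptionOf X × grundy x ≡ j
grundy-option-below (mk gs) {j} j<g
  with ∈-map⁻ grundy (subst (j ∈_) (grundyList≡map gs) (mex-below (grundyList gs) j j<g))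
... | x , p , j≡gx = x , p , sym j≡gx

-- Bit vectors

infixl 6 _⊻_
_⊻_ : ∀ {k} → Bits k → Bits k → Bits k
_⊻_ = zipWith _xor_

0s : ∀ {k} → Bits k
0s = replicate _ false

⊻-comm : ∀ {k} (u v : Bits k) → u ⊻ v ≡ v ⊻ u
⊻-comm = zipWith-comm xor-comm

⊻-assoc : ∀ {k} (u v w : Bits k) → (u ⊻ v) ⊻ w ≡ u ⊻ (v ⊻ w)
⊻-assoc = zipWith-assoc xor-assoc

⊻-identityˡ : ∀ {k} (v : Bits k) → 0s ⊻ v ≡ v
⊻-identityˡ = zipWith-identityˡ xor-identityˡ

⊻-identityʳ : ∀ {k} (v : Bits k) → v ⊻ 0s ≡ v
⊻-identityʳ = zipWith-identityʳ xor-identityʳ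

⊻-self : ∀ {k} (v : Bits k) → v ⊻ v ≡ 0s
⊻-self [] = refl
⊻-self (b ∷ v) = cong₂ _∷_ (xor-same b) (⊻-self v)

⊻-cancelˡ : ∀ {k} (u v : Bits k) → u ⊻ (u ⊻ v) ≡ v
⊻-cancelˡ u v = begin
  u ⊻ (u ⊻ v)  ≡⟨ ⊻-assoc u u v ⟨
  (u ⊻ u) ⊻ v  ≡⟨ cong (_⊻ v) (⊻-self u) ⟩
  0s ⊻ v       ≡⟨ ⊻-identityˡ v ⟩
  v            ∎

⊻-cancelʳ : ∀ {k} (u v : Bits k) → (u ⊻ v) ⊻ v ≡ u
⊻-cancelʳ u v = begin
  (u ⊻ v) ⊻ v  ≡⟨ ⊻-assoc u v v ⟩
  u ⊻ (v ⊻ v)  ≡⟨ cong (u ⊻_) (⊻-self v) ⟩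
  u ⊻ 0s       ≡⟨ ⊻-identityʳ u ⟩
  u            ∎

⊻≡0s⇒≡ : ∀ {k} (u v : Bits k) → u ⊻ v ≡ 0s → u ≡ v
⊻≡0s⇒≡ u v e = begin
  u            ≡⟨ ⊻-cancelˡ v u ⟨
  v ⊻ (v ⊻ u)  ≡⟨ cong (v ⊻_) (trans (⊻-comm v u) e) ⟩
  v ⊻ 0s       ≡⟨ ⊻-identityʳ v ⟩
  v            ∎

flip0≡oneBits⊻ : ∀ {k} (v : Bits (suc k)) → flip0 v ≡ oneBits (suc k) ⊻ v
flip0≡oneBits⊻ (b ∷ v) = cong (not b ∷_) (sym (⊻-identityˡ v))

allFalse : ∀ {k} → Bits k → Bool
allFalse [] = true
allFalse (b ∷ v) = not b ∧ allFalse v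

allFalse-0s : ∀ k → allFalse (0s {k}) ≡ true
allFalse-0s zero = refl
allFalse-0s (suc k) = allFalse-0s k

allFalse⇔≡0s : ∀ {k} {v : Bits k} → allFalse v ≡ true ⇔ v ≡ 0s
allFalse⇔≡0s = mk⇔ to from
  where
  to : ∀ {k} {v : Bits k} → allFalse v ≡ true → v ≡ 0s
  to {v = []} _ = refl
  to {v = false ∷ v} e = cong (false ∷_) (to e)
  from : ∀ {k} {v : Bits k} → v ≡ 0s → allFalse v ≡ true
  from {k} refl = allFalse-0s k

bit : Bool → ℕ
bit b = if b then 1 else 0

bit+2*-injective : ∀ b c {x y} → bit b + 2 * x ≡ bit c + 2 * y → b ≡ c × x ≡ y
bit+2*-injective false false e = refl , *-cancelˡ-≡ _ _ 2 e
bit+2*-injective true true e = refl , *-cancelˡ-≡ _ _ 2 (cong pred e)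
bit+2*-injective false true {x} {y} e = ⊥-elim (even≢odd x y e)
bit+2*-injective true false {x} {y} e = ⊥-elim (even≢odd y x (sym e))

val-injective : ∀ {k} (u v : Bits k) → val u ≡ val v → u ≡ v
val-injective [] [] _ = refl
val-injective (b ∷ u) (c ∷ v) e with bit+2*-injective b c e
... | refl , e′ = cong (b ∷_) (val-injective u v e′)

halve : ∀ m → ∃₂ λ b h → bit b + 2 * h ≡ m
halve zero = false , 0 , refl
halve (suc zero) = true , 0 , refl
halve (suc (suc m)) with halve m
... | b , h , e = b , suc h , trans (shift b) (cong (λ x → suc (suc x)) e)
  where
  shift : ∀ b → bit b + 2 * suc h ≡ suc (suc (bit b + 2 * h))
  shift false = cong suc (+-suc h (h + 0))
  shift true = cong (λ x → suc (suc x)) (+-suc h (h + 0))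

val-surjective : ∀ k {m} → m < 2 ^ k → Σ (Bits k) λ v → val v ≡ m
val-surjective zero {zero} _ = [] , refl
val-surjective zero {suc m} (s≤s ())
val-surjective (suc k) {m} m<2^k₊₁ with halve m
... | b , h , e = let (v , vh) = val-surjective k h<2^k in b ∷ v , trans (cong (λ x → bit b + 2 * x) vh) e
  where
  h<2^k : h < 2 ^ k
  h<2^k = *-cancelˡ-< 2 h (2 ^ k) (≤-<-trans (subst (2 * h ≤_) e (m≤n+m (2 * h) (bit b))) m<2^k₊₁)

val-0s : ∀ k → val (0s {k}) ≡ 0
val-0s zero = refl
val-0s (suc k) = cong (2 *_) (val-0s k)

val-oneBits : ∀ k → val (oneBits (suc k)) ≡ 1
val-oneBits k = cong (λ x → 1 + 2 * x) (val-0s k)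

val-∷ʳfalse : ∀ {k} (v : Bits k) → val (v ∷ʳ false) ≡ val v
val-∷ʳfalse [] = refl
val-∷ʳfalse (b ∷ v) = cong (λ x → bit b + 2 * x) (val-∷ʳfalse v)

val-0s∷ʳtrue : ∀ k → val (0s {k} ∷ʳ true) ≡ 2 ^ k
val-0s∷ʳtrue zero = refl
val-0s∷ʳtrue (suc k) = cong (2 *_) (val-0s∷ʳtrue k)

⊻-∷ʳ : ∀ {k} (u v : Bits k) b c → (u ∷ʳ b) ⊻ (v ∷ʳ c) ≡ (u ⊻ v) ∷ʳ (b xor c)
⊻-∷ʳ [] [] b c = refl
⊻-∷ʳ (x ∷ u) (y ∷ v) b c = cong (_ ∷_) (⊻-∷ʳ u v b c)

allBits : ∀ k → List (Bits k)
allBits zero = [] ∷ []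
allBits (suc k) = map (true ∷_) (allBits k) ++ map (false ∷_) (allBits k)

∈-allBits : ∀ {k} (v : Bits k) → v ∈ allBits k
∈-allBits [] = here refl
∈-allBits {suc k} (true ∷ v) = ∈-++⁺ˡ (∈-map⁺ (true ∷_) (∈-allBits v))
∈-allBits {suc k} (false ∷ v) = ∈-++⁺ʳ (map (true ∷_) (allBits k)) (∈-map⁺ (false ∷_) (∈-allBits v))

-- The monoid 𝒯

bits : ∀ {k} → 𝒯 k → Bits k
bits one = 0s
bits a = oneBits _
bits (z i) = i

isZ : ∀ {k} → 𝒯 k → Bool
isZ one = false
isZ a = false
isZ (z _) = true

-- The Grundy value shared by the games of a class: 1 ↦ 0, a ↦ 1, z_i ↦ i.
index : ∀ {k} → 𝒯 k → ℕ
index t = val (bits t)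

isDist : ∀ {k} → 𝒯 k → Bool
isDist one = false
isDist a = true
isDist (z i) = allFalse i

isDist⇔Dist : ∀ {k} {t : 𝒯 k} → isDist t ≡ true ⇔ Dist t
isDist⇔Dist = mk⇔ to from
  where
  to : ∀ {k} {t : 𝒯 k} → isDist t ≡ true → Dist t
  to {t = a} _ = inj₁ refl
  to {t = z i} e = inj₂ (cong z (Equivalence.to allFalse⇔≡0s e))
  from : ∀ {k} {t : 𝒯 k} → Dist t → isDist t ≡ true
  from (inj₁ refl) = refl
  from {k} (inj₂ refl) = allFalse-0s k

bits-· : ∀ {k} (x y : 𝒯 (suc k)) → bits (x · y) ≡ bits x ⊻ bits y
bits-· one y = sym (⊻-identityˡ (bits y))
bits-· a one = sym (⊻-identityʳ _)
bits-· a a = sym (⊻-self (oneBits _))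
bits-· a (z j) = flip0≡oneBits⊻ j
bits-· (z i) one = sym (⊻-identityʳ i)
bits-· (z i) a = trans (flip0≡oneBits⊻ i) (⊻-comm _ i)
bits-· (z i) (z j) = refl

isZ-· : ∀ {k} (x y : 𝒯 k) → isZ (x · y) ≡ isZ x ∨ isZ y
isZ-· one y = refl
isZ-· a one = refl
isZ-· a a = refl
isZ-· a (z j) = refl
isZ-· (z i) one = refl
isZ-· (z i) a = refl
isZ-· (z i) (z j) = refl

-- 𝒯_(k+1) embeds into (Bool, ∨) × (Bits (k+1), ⊻), which yields its monoid laws.
isZ-bits-injective : ∀ {k} {x y : 𝒯 (suc k)} → isZ x ≡ isZ y → bits x ≡ bits y → x ≡ y
isZ-bits-injective {x = one} {one} _ _ = refl
isZ-bits-injective {x = a} {a} _ _ = refl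
isZ-bits-injective {x = z i} {z j} _ refl = refl
isZ-bits-injective {x = one} {a} _ ()
isZ-bits-injective {x = a} {one} _ ()
isZ-bits-injective {x = one} {z _} () _
isZ-bits-injective {x = a} {z _} () _
isZ-bits-injective {x = z _} {one} () _
isZ-bits-injective {x = z _} {a} () _

·-comm : ∀ {k} (x y : 𝒯 (suc k)) → x · y ≡ y · x
·-comm x y = isZ-bits-injective
  (trans (isZ-· x y) (trans (∨-comm (isZ x) (isZ y)) (sym (isZ-· y x))))
  (trans (bits-· x y) (trans (⊻-comm (bits x) (bits y)) (sym (bits-· y x))))

·-assoc : ∀ {k} (x y w : 𝒯 (suc k)) → (x · y) · w ≡ x · (y · w)
·-assoc x y w = isZ-bits-injective
  (begin
    isZ ((x · y) · w)         ≡⟨ isZ-· (x · y) w ⟩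
    isZ (x · y) ∨ isZ w       ≡⟨ cong (_∨ isZ w) (isZ-· x y) ⟩
    (isZ x ∨ isZ y) ∨ isZ w   ≡⟨ ∨-assoc (isZ x) (isZ y) (isZ w) ⟩
    isZ x ∨ (isZ y ∨ isZ w)   ≡⟨ cong (isZ x ∨_) (isZ-· y w) ⟨
    isZ x ∨ isZ (y · w)       ≡⟨ isZ-· x (y · w) ⟨
    isZ (x · (y · w))         ∎)
  (begin
    bits ((x · y) · w)            ≡⟨ bits-· (x · y) w ⟩
    bits (x · y) ⊻ bits w         ≡⟨ cong (_⊻ bits w) (bits-· x y) ⟩
    (bits x ⊻ bits y) ⊻ bits w    ≡⟨ ⊻-assoc (bits x) (bits y) (bits w) ⟩
    bits x ⊻ (bits y ⊻ bits w)    ≡⟨ cong (bits x ⊻_) (bits-· y w) ⟨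
    bits x ⊻ bits (y · w)         ≡⟨ bits-· x (y · w) ⟨
    bits (x · (y · w))            ∎)

·-identityʳ : ∀ {k} (x : 𝒯 k) → x · one ≡ x
·-identityʳ one = refl
·-identityʳ a = refl
·-identityʳ (z i) = refl

·-interchange : ∀ {k} (p q r s : 𝒯 (suc k)) → (p · q) · (r · s) ≡ (p · r) · (q · s)
·-interchange p q r s = begin
  (p · q) · (r · s)  ≡⟨ ·-assoc p q (r · s) ⟩
  p · (q · (r · s))  ≡⟨ cong (p ·_) (·-assoc q r s) ⟨
  p · ((q · r) · s)  ≡⟨ cong (λ t → p · (t · s)) (·-comm q r) ⟩
  p · ((r · q) · s)  ≡⟨ cong (p ·_) (·-assoc r q s) ⟩
  p · (r · (q · s))  ≡⟨ ·-assoc p r (q · s) ⟨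
  (p · r) · (q · s)  ∎

infixr 30 _^ᵀ_
_^ᵀ_ : ∀ {k} → 𝒯 k → ℕ → 𝒯 k
t ^ᵀ zero = one
t ^ᵀ suc j = t · t ^ᵀ j

^ᵀ-+ : ∀ {k} (t : 𝒯 (suc k)) i j → t ^ᵀ (i + j) ≡ t ^ᵀ i · t ^ᵀ j
^ᵀ-+ t zero j = refl
^ᵀ-+ t (suc i) j = trans (cong (t ·_) (^ᵀ-+ t i j)) (sym (·-assoc t (t ^ᵀ i) (t ^ᵀ j)))

one-^ᵀ : ∀ {k} j → one {k} ^ᵀ j ≡ one
one-^ᵀ zero = refl
one-^ᵀ (suc j) = one-^ᵀ j

a-^ᵀ : ∀ {k} j → a {k} ^ᵀ j ≡ a ⊎ a {k} ^ᵀ j ≡ one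
a-^ᵀ zero = inj₂ refl
a-^ᵀ (suc j) with a-^ᵀ j
... | inj₁ aʲ≡a = inj₂ (cong (a ·_) aʲ≡a)
... | inj₂ aʲ≡one = inj₁ (cong (a ·_) aʲ≡one)

·z≡z : ∀ {k} (x : 𝒯 (suc k)) i → x · z i ≡ z (bits x ⊻ i)
·z≡z one i = cong z (sym (⊻-identityˡ i))
·z≡z a i = cong z (flip0≡oneBits⊻ i)
·z≡z (z j) i = refl

isDist-·z⇔ : ∀ {k} (x : 𝒯 (suc k)) i → isDist (x · z i) ≡ true ⇔ bits x ≡ i
isDist-·z⇔ x i rewrite ·z≡z x i = mk⇔
  (λ d → ⊻≡0s⇒≡ (bits x) i (Equivalence.to allFalse⇔≡0s d))
  (λ { refl → Equivalence.from allFalse⇔≡0s (⊻-self (bits x)) })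

bits-isDist-injective : ∀ {k} {x y : 𝒯 (suc k)} → bits x ≡ bits y → isDist x ≡ isDist y → x ≡ y
bits-isDist-injective {x = one} {one} _ _ = refl
bits-isDist-injective {x = a} {a} _ _ = refl
bits-isDist-injective {x = z i} {z j} refl _ = refl
bits-isDist-injective {x = one} {a} () _
bits-isDist-injective {x = a} {one} () _
bits-isDist-injective {x = a} {z _} refl ()
bits-isDist-injective {x = z _} {a} refl ()
bits-isDist-injective {k} {x = one} {z _} refl d = ⊥-elim (false≢true (trans d (allFalse-0s (suc k))))
bits-isDist-injective {k} {x = z _} {one} refl d = ⊥-elim (false≢true (trans (sym d) (allFalse-0s (suc k))))

·-reduced : ∀ {k} (x y : 𝒯 (suc k)) → (∀ s → isDist (x · s) ≡ isDist (y · s)) → x ≡ y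
·-reduced x y h = bits-isDist-injective bits≡ isDist≡
  where
  bits≡ : bits x ≡ bits y
  bits≡ = Equivalence.to (isDist-·z⇔ x (bits y))
    (trans (h (z (bits y))) (Equivalence.from (isDist-·z⇔ y (bits y)) refl))
  isDist≡ : isDist x ≡ isDist y
  isDist≡ = trans (cong isDist (sym (·-identityʳ x))) (trans (h one) (cong isDist (·-identityʳ y)))

_≟ᵀ_ : ∀ {k} → DecidableEquality (𝒯 k)
one ≟ᵀ one = yes refl
one ≟ᵀ a = no λ ()
one ≟ᵀ z _ = no λ ()
a ≟ᵀ one = no λ ()
a ≟ᵀ a = yes refl
a ≟ᵀ z _ = no λ ()
z _ ≟ᵀ one = no λ ()
z _ ≟ᵀ a = no λ ()
z i ≟ᵀ z j with Vec.≡-dec _≟ᴮ_ i j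
... | yes refl = yes refl
... | no i≢j = no λ { refl → i≢j refl }

all𝒯 : ∀ k → List (𝒯 k)
all𝒯 k = one ∷ a ∷ map z (allBits k)

∈-all𝒯 : ∀ {k} (t : 𝒯 k) → t ∈ all𝒯 k
∈-all𝒯 one = here refl
∈-all𝒯 a = there (here refl)
∈-all𝒯 (z i) = there (there (∈-map⁺ z (∈-allBits i)))

embed-· : ∀ {k} (x y : 𝒯 (suc k)) → embed (x · y) ≡ embed x · embed y
embed-· one y = refl
embed-· a one = refl
embed-· a a = refl
embed-· a (z (b ∷ v)) = refl
embed-· (z i) one = refl
embed-· (z (b ∷ v)) a = refl
embed-· (z i) (z j) = cong z (sym (⊻-∷ʳ i j false false))

isDist-embed : ∀ {k} (x : 𝒯 k) → isDist (embed x) ≡ isDist x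
isDist-embed one = refl
isDist-embed a = refl
isDist-embed (z i) = allFalse-∷ʳfalse i
  where
  allFalse-∷ʳfalse : ∀ {k} (v : Bits k) → allFalse (v ∷ʳ false) ≡ allFalse v
  allFalse-∷ʳfalse [] = refl
  allFalse-∷ʳfalse (b ∷ v) = cong (not b ∧_) (allFalse-∷ʳfalse v)

index-embed : ∀ {k} (x : 𝒯 (suc k)) → index (embed x) ≡ index x
index-embed {k} one = trans (val-0s (suc (suc k))) (sym (val-0s (suc k)))
index-embed {k} a = trans (val-oneBits (suc k)) (sym (val-oneBits k))
index-embed (z i) = val-∷ʳfalse i

isDist-·⇒ : ∀ {k} (t γ : 𝒯 (suc k)) → isDist (t · γ) ≡ true
          → bits t ≡ bits γ ⊎ (t ≡ one × γ ≡ a) ⊎ (t ≡ a × γ ≡ one)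
isDist-·⇒ t (z j) d = inj₁ (Equivalence.to (isDist-·z⇔ t j) d)
isDist-·⇒ (z i) γ d = inj₁ (sym (Equivalence.to (isDist-·z⇔ γ i) (trans (cong isDist (·-comm γ (z i))) d)))
isDist-·⇒ one a _ = inj₂ (inj₁ (refl , refl))
isDist-·⇒ a one _ = inj₂ (inj₂ (refl , refl))

bits≡⇒isDist-· : ∀ {k} (t γ : 𝒯 (suc k)) → bits t ≡ bits γ
               → isDist (t · γ) ≡ true ⊎ (t ≡ one × γ ≡ one) ⊎ (t ≡ a × γ ≡ a)
bits≡⇒isDist-· t (z j) e = inj₁ (Equivalence.from (isDist-·z⇔ t j) e)
bits≡⇒isDist-· (z i) γ e = inj₁ (trans (cong isDist (·-comm (z i) γ)) (Equivalence.from (isDist-·z⇔ γ i) (sym e)))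
bits≡⇒isDist-· one one _ = inj₂ (inj₁ (refl , refl))
bits≡⇒isDist-· a a _ = inj₂ (inj₂ (refl , refl))

isDist-·-isDist⇒ : ∀ {k} (t γ : 𝒯 (suc k)) → isDist t ≡ true → isDist (t · γ) ≡ true
                → γ ≡ one ⊎ γ ≡ z₀ ⊎ γ ≡ z₁
isDist-·-isDist⇒ t one _ _ = inj₁ refl
isDist-·-isDist⇒ t (z j) dt d with Equivalence.to (isDist⇔Dist {t = t}) dt
isDist-·-isDist⇒ .a (z j) dt d | inj₁ refl with Equivalence.to (isDist-·z⇔ a j) d
... | refl = inj₂ (inj₂ refl)
isDist-·-isDist⇒ .z₀ (z j) dt d | inj₂ refl with Equivalence.to (isDist-·z⇔ z₀ j) d
... | refl = inj₂ (inj₁ refl)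
isDist-·-isDist⇒ t a dt d with Equivalence.to (isDist⇔Dist {t = t}) dt
isDist-·-isDist⇒ .a a _ () | inj₁ refl
isDist-·-isDist⇒ .z₀ a _ () | inj₂ refl

a·a· : ∀ {k} (t : 𝒯 k) → a · (a · t) ≡ t
a·a· one = refl
a·a· a = refl
a·a· (z []) = refl
a·a· (z (b ∷ v)) = cong (λ c → z (c ∷ v)) (not-involutive b)

index≡0⇒ : ∀ {k} (t : 𝒯 (suc k)) → index t ≡ 0 → t ≡ one ⊎ t ≡ z₀
index≡0⇒ {k} t it≡0 with val-injective (bits t) 0s (trans it≡0 (sym (val-0s (suc k))))
index≡0⇒ one _ | _ = inj₁ refl
index≡0⇒ (z i) _ | refl = inj₂ refl

index≡1⇒ : ∀ {k} (t : 𝒯 (suc k)) → index t ≡ 1 → t ≡ a ⊎ t ≡ z₁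
index≡1⇒ {k} t it≡1 with val-injective (bits t) (oneBits (suc k)) (trans it≡1 (sym (val-oneBits k)))
index≡1⇒ a _ | _ = inj₁ refl
index≡1⇒ (z i) _ | refl = inj₂ refl

record IsEmbedding {k l} (e : 𝒯 (suc k) → 𝒯 (suc l)) : Set where
  field
    e-one : e one ≡ one
    e-· : ∀ x y → e (x · y) ≡ e x · e y
    isDist-e : ∀ x → isDist (e x) ≡ isDist x
    index-e : ∀ x → index (e x) ≡ index x

id-isEmbedding : ∀ {k} → IsEmbedding {k} (λ x → x)
id-isEmbedding = record { e-one = refl ; e-· = λ _ _ → refl ; isDist-e = λ _ → refl ; index-e = λ _ → refl }

embed-isEmbedding : ∀ {k} → IsEmbedding {k} embed
embed-isEmbedding = record { e-one = refl ; e-· = embed-· ; isDist-e = isDist-embed ; index-e = index-embed }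

-- Extending a misère quotient by one game

module Quotient {n : ℕ} (𝒜 : GameSet) (𝒜-closed : Closed 𝒜)
  (φ : Game → 𝒯 (suc n)) (φ-iso : IsQuotientIso 𝒜 φ) (φ-faithful : Faithful 𝒜 φ)
  (grundy-z : ∀ {X} i → 𝒜 X → φ X ≡ z i → grundy X ≡ val i) where

  open Closed 𝒜-closed
  open import Data.List.Membership.DecPropositional (_≟ᵀ_ {suc n}) using (_∈?_)
  open IsQuotientIso φ-iso

  isP≡isDist∘φ : ∀ {Y} → 𝒜 Y → isP Y ≡ isDist (φ Y)
  isP≡isDist∘φ Y∈ = ⇔→≡ {z = true} (mk⇔
    (λ PY → Equivalence.from isDist⇔Dist (dist-to Y∈ PY))
    (λ d → dist-from Y∈ (Equivalence.to isDist⇔Dist d)))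

  rep𝒜 : 𝒯 (suc n) → Game
  rep𝒜 t = proj₁ (surjective t)

  rep𝒜∈𝒜 : ∀ t → 𝒜 (rep𝒜 t)
  rep𝒜∈𝒜 t = proj₁ (proj₂ (surjective t))

  φ-rep𝒜 : ∀ t → φ (rep𝒜 t) ≡ t
  φ-rep𝒜 t = proj₂ (proj₂ (surjective t))

  grundy-one : ∀ {Y} → 𝒜 Y → φ Y ≡ one → grundy Y ≡ 0
  grundy-one Y∈ φY≡one = φ-faithful Y∈ has-zero (trans φY≡one (sym hom-zero))

  -- The hypotheses give Grundy values only on the classes z_i; this game pins down that of the class a.
  record Star1 : Set where
    field
      game : Game
      ∈𝒜 : 𝒜 game
      φ≡a : φ game ≡ a
      options-φ≡one : ∀ {w} → w isOptionOf game → φ w ≡ one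

  z-class-option : ∀ {X} i → 𝒜 X → φ X ≡ z i → ∃ λ x → x isOptionOf X × φ x ≢ one
  z-class-option {X} i X∈ φX≡zi with isP X in PX
  ... | true = let (x , p) = P⇒option X PX in
      x , p , λ φx≡one → grundy-option≢ X p (trans (grundy-one (opt-closed X∈ p) φx≡one) (sym grundyX≡0))
    where
    i≡0s : i ≡ 0s
    i≡0s = Equivalence.to allFalse⇔≡0s (trans (sym (cong isDist φX≡zi)) (trans (sym (isP≡isDist∘φ X∈)) PX))
    grundyX≡0 : grundy X ≡ 0
    grundyX≡0 = trans (grundy-z i X∈ φX≡zi) (trans (cong val i≡0s) (val-0s (suc n)))
  ... | false with N-elim X PX
  ...   | inj₁ refl with trans (sym φX≡zi) hom-zero
  ...     | ()
  z-class-option {X} i X∈ φX≡zi | false | inj₂ (x , p , Px) =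
      x , p , λ φx≡one → false≢true (trans (cong isDist (sym φx≡one)) (trans (sym (isP≡isDist∘φ (opt-closed X∈ p))) Px))

  find-star1 : ∀ {X} → Acc _isOptionOf_ X → 𝒜 X → φ X ≢ one → Star1
  find-star1 {X} (acc rs) X∈ φX≢one with φ X in φX
  ... | one = ⊥-elim (φX≢one refl)
  ... | z i = let (x , p , φx≢one) = z-class-option i X∈ φX in find-star1 (rs p) (opt-closed X∈ p) φx≢one
  ... | a with any? (λ x → ¬? (φ x ≟ᵀ one)) (options X)
  ...   | yes some = let (x , p , φx≢one) = find some in find-star1 (rs p) (opt-closed X∈ p) φx≢one
  ...   | no none = record { game = X ; ∈𝒜 = X∈ ; φ≡a = φX ; options-φ≡one = options-one }
    where
    options-one : ∀ {w} → w isOptionOf X → φ w ≡ one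
    options-one {w} p with φ w ≟ᵀ one
    ... | yes φw≡one = φw≡one
    ... | no φw≢one = ⊥-elim (none (lose p φw≢one))

  star1 : Star1
  star1 = let (X , X∈ , φX≡a) = surjective a in
    find-star1 (isOptionOf-wellFounded X) X∈ λ φX≡one → a≢one (trans (sym φX≡a) φX≡one)
    where
    a≢one : a ≢ one
    a≢one ()

  open Star1 star1 renaming (game to W; ∈𝒜 to W∈𝒜; φ≡a to φW≡a; options-φ≡one to φ-options-W≡one)

  grundy-options-W : ∀ {w} → w isOptionOf W → grundy w ≡ 0
  grundy-options-W p = grundy-one (opt-closed W∈𝒜 p) (φ-options-W≡one p)

  grundy-W : grundy W ≡ 1
  grundy-W with grundy W in gW
  ... | zero = ⊥-elim (grundy-option≢ W p (trans (grundy-options-W p) (sym gW)))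
    where
    p = proj₂ (P⇒option W (trans (isP≡isDist∘φ W∈𝒜) (cong isDist φW≡a)))
  ... | suc zero = refl
  ... | suc (suc _) = let (w , p , gw≡1) = grundy-option-below W (subst (1 <_) (sym gW) (s≤s (s≤s z≤n))) in
      ⊥-elim (1≢0 (trans (sym gw≡1) (grundy-options-W p)))
    where
    1≢0 : 1 ≢ 0
    1≢0 ()

  isP-⊕W : ∀ {Y} → 𝒜 Y → isP (Y ⊕ W) ≡ isDist (φ Y · a)
  isP-⊕W {Y} Y∈ = trans (isP≡isDist∘φ (sum-closed Y∈ W∈𝒜)) (cong isDist (trans (hom-sum Y∈ W∈𝒜) (cong (φ Y ·_) φW≡a)))

  isDist∘φ-options : ∀ {Y} → 𝒜 Y → isDist (φ Y) ≡ true → ∀ {Y′} → Y′ isOptionOf Y → isDist (φ Y′) ≡ false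
  isDist∘φ-options {Y} Y∈ dY q =
    trans (sym (isP≡isDist∘φ (opt-closed Y∈ q))) (P⇒options-N Y (trans (isP≡isDist∘φ Y∈) dY) q)

  ¬isDist∘φ-elim : ∀ {Y} → 𝒜 Y → isDist (φ Y) ≡ false → Y ≡ 𝟘 ⊎ (∃ λ Y′ → Y′ isOptionOf Y × isDist (φ Y′) ≡ true)
  ¬isDist∘φ-elim {Y} Y∈ dY with N-elim Y (trans (isP≡isDist∘φ Y∈) dY)
  ... | inj₁ Y≡𝟘 = inj₁ Y≡𝟘
  ... | inj₂ (Y′ , q , PY′) = inj₂ (Y′ , q , trans (sym (isP≡isDist∘φ (opt-closed Y∈ q))) PY′)

  -- Y + W plays like Y + *1: its options are Y′ + W and Y + w with w in the class 1.
  ¬isDist-·a-elim : ∀ {Y} → 𝒜 Y → isDist (φ Y) ≡ false → isDist (φ Y · a) ≡ false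
                  → ∃ λ Y′ → Y′ isOptionOf Y × isDist (φ Y′ · a) ≡ true
  ¬isDist-·a-elim {Y} Y∈ dY dYa with N-elim (Y ⊕ W) (trans (isP-⊕W Y∈) dYa)
  ... | inj₁ Y⊕W≡𝟘 = let (w , p) = P⇒option W (trans (isP≡isDist∘φ W∈𝒜) (cong isDist φW≡a)) in
        ⊥-elim (no-option-of-𝟘 (subst ((Y ⊕ w) isOptionOf_) Y⊕W≡𝟘 (⊕-optionʳ Y W p)))
    where
    no-option-of-𝟘 : ∀ {x} → ¬ x isOptionOf 𝟘
    no-option-of-𝟘 ()
  ... | inj₂ (x , p , Px) with ⊕-option⁻ Y W p
  ...   | inj₁ (Y′ , q , refl) = Y′ , q , trans (sym (isP-⊕W (opt-closed Y∈ q))) Px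
  ...   | inj₂ (w , q , refl) = ⊥-elim (false≢true (begin
          false               ≡⟨ dY ⟨
          isDist (φ Y)        ≡⟨ cong isDist (trans (cong (φ Y ·_) (φ-options-W≡one q)) (·-identityʳ (φ Y))) ⟨
          isDist (φ Y · φ w)  ≡⟨ cong isDist (hom-sum Y∈ (opt-closed W∈𝒜 q)) ⟨
          isDist (φ (Y ⊕ w))  ≡⟨ isP≡isDist∘φ (sum-closed Y∈ (opt-closed W∈𝒜 q)) ⟨
          isP (Y ⊕ w)         ≡⟨ Px ⟩
          true                ∎))

  grundy≡index∘φ : ∀ {Y} → 𝒜 Y → grundy Y ≡ index (φ Y)
  grundy≡index∘φ {Y} Y∈ with φ Y in φY
  ... | one = trans (grundy-one Y∈ φY) (sym (val-0s (suc n)))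
  ... | a = trans (φ-faithful Y∈ W∈𝒜 (trans φY (sym φW≡a))) (trans grundy-W (sym (val-oneBits n)))
  ... | z i = grundy-z i Y∈ φY

  module WithGame (G : Game) (G-options : ∀ {G′} → G′ isOptionOf G → 𝒜 G′) where

    infix 4 _∈Φ''G
    _∈Φ''G : 𝒯 (suc n) → Set
    t ∈Φ''G = t ∈Φ'' G [ φ ]

    _∈Φ''G? : ∀ t → Dec (t ∈Φ''G)
    t ∈Φ''G? = any? (λ G′ → φ G′ ≟ᵀ t) (options G)

    option⇒∈Φ''G : ∀ {G′} → G′ isOptionOf G → φ G′ ∈Φ''G
    option⇒∈Φ''G p = lose p refl

    index≡grundy⇒∉Φ''G : ∀ t → index t ≡ grundy G → ¬ t ∈Φ''G
    index≡grundy⇒∉Φ''G t it≡m t∈ = let (G′ , p , φG′≡t) = find t∈ in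
      grundy-option≢ G p (trans (grundy≡index∘φ (G-options p)) (trans (cong index φG′≡t) it≡m))

    four-one : InFour {suc n} one
    four-one = inj₁ refl
    four-a : InFour {suc n} a
    four-a = inj₂ (inj₁ refl)
    four-z : InFour {suc n} z₀
    four-z = inj₂ (inj₂ (inj₁ refl))
    four-az : InFour {suc n} z₁
    four-az = inj₂ (inj₂ (inj₂ refl))

    Δ≐-intro : ∀ S → All (λ t → t ∈Φ''G × InFour t) S
             → (one ∈Φ''G → one ∈ S) → (a ∈Φ''G → a ∈ S) → (z₀ ∈Φ''G → z₀ ∈ S) → (z₁ ∈Φ''G → z₁ ∈ S)
             → Δ≐ φ G S
    Δ≐-intro S members h-one h-a h-z h-az t = included , All.lookup members
      where
      included : t ∈Φ''G × InFour t → t ∈ S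
      included (t∈ , inj₁ refl) = h-one t∈
      included (t∈ , inj₂ (inj₁ refl)) = h-a t∈
      included (t∈ , inj₂ (inj₂ (inj₁ refl))) = h-z t∈
      included (t∈ , inj₂ (inj₂ (inj₂ refl))) = h-az t∈

    Δ≐⇒∈ : ∀ {S t} → Δ≐ φ G S → InFour t → t ∈Φ''G → t ∈ S
    Δ≐⇒∈ {t = t} Δ four t∈ = proj₁ (Δ t) (t∈ , four)

    Δ≐⇒∈Φ''G : ∀ {S t} → Δ≐ φ G S → t ∈ S → t ∈Φ''G
    Δ≐⇒∈Φ''G {t = t} Δ t∈S = proj₁ (proj₂ (Δ t) t∈S)

    Δ≐? : ∀ S → Dec (Δ≐ φ G S)
    Δ≐? S = map′ to from
      (all? (λ t → t ∈Φ''G? ×-dec InFour? t) S ×-dec included? one ×-dec included? a ×-dec included? z₀ ×-dec included? z₁)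
      where
      InFour? : ∀ t → Dec (InFour t)
      InFour? t = t ≟ᵀ one ⊎-dec t ≟ᵀ a ⊎-dec t ≟ᵀ z₀ ⊎-dec t ≟ᵀ z₁
      Included : 𝒯 (suc n) → Set
      Included t = t ∈Φ''G → t ∈ S
      included? : ∀ t → Dec (Included t)
      included? t = t ∈Φ''G? →-dec t ∈? S
      to : All (λ t → t ∈Φ''G × InFour t) S × Included one × Included a × Included z₀ × Included z₁ → Δ≐ φ G S
      to (members , h-one , h-a , h-z , h-az) = Δ≐-intro S members h-one h-a h-z h-az
      from : Δ≐ φ G S → All (λ t → t ∈Φ''G × InFour t) S × Included one × Included a × Included z₀ × Included z₁
      from Δ = All.tabulate (λ {t} → proj₂ (Δ t)) , Δ≐⇒∈ Δ four-one , Δ≐⇒∈ Δ four-a , Δ≐⇒∈ Δ four-z , Δ≐⇒∈ Δ four-az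

    module Tameness (tame : Tame φ G) (Δ≢a : ¬ Δ≐ φ G (a ∷ [])) (Δ≢1 : ¬ Δ≐ φ G (one ∷ [])) where

      a∈Δ⇒z,az∈Δ : a ∈Φ''G → ¬ one ∈Φ''G → z₀ ∈Φ''G × z₁ ∈Φ''G
      a∈Δ⇒z,az∈Δ a∈ 1∉ with z₀ ∈Φ''G? | z₁ ∈Φ''G?
      ... | yes z∈ | yes az∈ = z∈ , az∈
      ... | yes z∈ | no az∉ = ⊥-elim (proj₁ (proj₂ (proj₂ tame))
            (Δ≐-intro (a ∷ z₀ ∷ []) ((a∈ , four-a) ∷ (z∈ , four-z) ∷ [])
              (⊥-elim ∘ 1∉) (λ _ → here refl) (λ _ → there (here refl)) (⊥-elim ∘ az∉)))
      ... | no z∉ | yes az∈ = ⊥-elim (proj₁ (proj₂ tame)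
            (Δ≐-intro (a ∷ z₁ ∷ []) ((a∈ , four-a) ∷ (az∈ , four-az) ∷ [])
              (⊥-elim ∘ 1∉) (λ _ → here refl) (⊥-elim ∘ z∉) (λ _ → there (here refl))))
      ... | no z∉ | no az∉ = ⊥-elim (Δ≢a
            (Δ≐-intro (a ∷ []) ((a∈ , four-a) ∷ [])
              (⊥-elim ∘ 1∉) (λ _ → here refl) (⊥-elim ∘ z∉) (⊥-elim ∘ az∉)))

      one∈Δ⇒z,az∈Δ : one ∈Φ''G → ¬ a ∈Φ''G → z₀ ∈Φ''G × z₁ ∈Φ''G
      one∈Δ⇒z,az∈Δ 1∈ a∉ with z₀ ∈Φ''G? | z₁ ∈Φ''G?
      ... | yes z∈ | yes az∈ = z∈ , az∈
      ... | yes z∈ | no az∉ = ⊥-elim (proj₁ tame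
            (Δ≐-intro (one ∷ z₀ ∷ []) ((1∈ , four-one) ∷ (z∈ , four-z) ∷ [])
              (λ _ → here refl) (⊥-elim ∘ a∉) (λ _ → there (here refl)) (⊥-elim ∘ az∉)))
      ... | no z∉ | yes az∈ = ⊥-elim (proj₂ (proj₂ (proj₂ tame))
            (Δ≐-intro (one ∷ z₁ ∷ []) ((1∈ , four-one) ∷ (az∈ , four-az) ∷ [])
              (λ _ → here refl) (⊥-elim ∘ a∉) (⊥-elim ∘ z∉) (λ _ → there (here refl))))
      ... | no z∉ | no az∉ = ⊥-elim (Δ≢1
            (Δ≐-intro (one ∷ []) ((1∈ , four-one) ∷ [])
              (λ _ → here refl) (⊥-elim ∘ a∉) (⊥-elim ∘ z∉) (⊥-elim ∘ az∉)))

    ℬ : GameSet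
    ℬ = cl (λ X → 𝒜 X ⊎ X ≡ G)

    copies : ℕ → Game
    copies zero = 𝟘
    copies (suc k) = G ⊕ copies k

    copies-+ : ∀ i j → copies i ⊕ copies j ≈ copies (i + j)
    copies-+ zero j = ⊕-identityˡ (copies j)
    copies-+ (suc i) j = ≈-trans (⊕-assoc G (copies i) (copies j)) (⊕-cong ≈-refl (copies-+ i j))

    option-of-copies : ∀ k {V} → V isOptionOf copies (suc k) → ∃ λ G′ → G′ isOptionOf G × V ≈ G′ ⊕ copies k
    option-of-copies k p with ⊕-option⁻ G (copies k) p
    ... | inj₁ (G′ , q , refl) = G′ , q , ≈-refl
    option-of-copies (suc j) p | inj₂ (V , q , refl) =
      let (G′ , q′ , V≈) = option-of-copies j q in G′ , q′ , ≈-trans (⊕-cong ≈-refl V≈) (⊕-leftComm G G′ (copies j))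

    options-split : ∀ {X Y k x} → X ≈ Y ⊕ copies k → x isOptionOf X
                  → (∃ λ Y′ → Y′ isOptionOf Y × x ≈ Y′ ⊕ copies k)
                  ⊎ (∃ λ j → k ≡ suc j × ∃ λ G′ → G′ isOptionOf G × x ≈ (Y ⊕ G′) ⊕ copies j)
    options-split {Y = Y} {k} (bisim fwd _) p with fwd p
    ... | w , q , x≈w with ⊕-option⁻ Y (copies k) q
    ...   | inj₁ (Y′ , q′ , refl) = inj₁ (Y′ , q′ , x≈w)
    options-split {Y = Y} {suc j} _ p | w , q , x≈w | inj₂ (V , q′ , refl) =
      let (G′ , q″ , V≈) = option-of-copies j q′ in
      inj₂ (j , refl , G′ , q″ , ≈-trans x≈w (≈-trans (⊕-cong ≈-refl V≈) (≈-sym (⊕-assoc Y G′ (copies j)))))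

    option-via-core : ∀ {X Y k Y′} → X ≈ Y ⊕ copies k → Y′ isOptionOf Y → ∃ λ x → x isOptionOf X × x ≈ Y′ ⊕ copies k
    option-via-core {Y = Y} {k} (bisim _ bwd) q = bwd (⊕-optionˡ Y (copies k) q)

    option-via-G : ∀ {X Y j G′} → X ≈ Y ⊕ copies (suc j) → G′ isOptionOf G → ∃ λ x → x isOptionOf X × x ≈ (Y ⊕ G′) ⊕ copies j
    option-via-G {Y = Y} {j} {G′} (bisim _ bwd) q =
      let (x , p , x≈) = bwd (⊕-optionʳ Y (copies (suc j)) (⊕-optionˡ G (copies j) q)) in
      x , p , ≈-trans x≈ (≈-sym (⊕-assoc Y G′ (copies j)))

    record Decomposition (X : Game) : Set where
      constructor decomposition
      field
        core : Game
        count : ℕ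
        core∈𝒜 : 𝒜 core
        ≈core⊕copies : X ≈ core ⊕ copies count

    decomposition-𝒜 : ∀ {Y} → 𝒜 Y → Decomposition Y
    decomposition-𝒜 {Y} Y∈ = decomposition Y 0 Y∈ (≡⇒≈ (sym (⊕-identityʳ Y)))

    decomposition-G : Decomposition G
    decomposition-G = decomposition 𝟘 1 has-zero (≈-sym (≈-trans (⊕-identityˡ (G ⊕ 𝟘)) (≡⇒≈ (⊕-identityʳ G))))

    decomposition-⊕ : ∀ {X₁ X₂} → Decomposition X₁ → Decomposition X₂ → Decomposition (X₁ ⊕ X₂)
    decomposition-⊕ (decomposition Y₁ k₁ Y₁∈ X₁≈) (decomposition Y₂ k₂ Y₂∈ X₂≈) =
      decomposition (Y₁ ⊕ Y₂) (k₁ + k₂) (sum-closed Y₁∈ Y₂∈)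
        (≈-trans (⊕-cong X₁≈ X₂≈) (≈-trans (⊕-interchange Y₁ (copies k₁) Y₂ (copies k₂)) (⊕-cong ≈-refl (copies-+ k₁ k₂))))

    decomposition-option : ∀ {X x} → Decomposition X → x isOptionOf X → Decomposition x
    decomposition-option (decomposition Y k Y∈ X≈) p with options-split {k = k} X≈ p
    ... | inj₁ (Y′ , q , x≈) = decomposition Y′ k (opt-closed Y∈ q) x≈
    ... | inj₂ (j , _ , G′ , q , x≈) = decomposition (Y ⊕ G′) j (sum-closed Y∈ (G-options q)) x≈

    decompose : ∀ {X} → ℬ X → Decomposition X
    decompose (base (inj₁ X∈)) = decomposition-𝒜 X∈
    decompose (base (inj₂ refl)) = decomposition-G
    decompose zero∈ = decomposition-𝒜 has-zero
    decompose (opt∈ B p) = decomposition-option (decompose B) p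
    decompose (sum∈ B₁ B₂) = decomposition-⊕ (decompose B₁) (decompose B₂)

    -- f Y and h Y stand for the classes of Y + (j+1)·G and Y + j·G.
    LosingRuleFor : ∀ {l} → (Game → 𝒯 (suc l)) → (Game → 𝒯 (suc l)) → Set
    LosingRuleFor f h = ∀ {Y} → 𝒜 Y → isDist (f Y) ≡ true
                      → (∀ {Y′} → Y′ isOptionOf Y → isDist (f Y′) ≡ false)
                      × (∀ {G′} → G′ isOptionOf G → isDist (h (Y ⊕ G′)) ≡ false)

    WinningRuleFor : ∀ {l} → (Game → 𝒯 (suc l)) → (Game → 𝒯 (suc l)) → Set
    WinningRuleFor f h = ∀ {Y} → 𝒜 Y → isDist (f Y) ≡ false
                       → (∃ λ Y′ → Y′ isOptionOf Y × isDist (f Y′) ≡ true)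
                       ⊎ (∃ λ G′ → G′ isOptionOf G × isDist (h (Y ⊕ G′)) ≡ true)

    losing-resp : ∀ {l} {f f′ h h′ : Game → 𝒯 (suc l)} → f ≗ f′ → h ≗ h′ → LosingRuleFor f h → LosingRuleFor f′ h′
    losing-resp f≗f′ h≗h′ L {Y} Y∈ d =
      let (L-core , L-G) = L Y∈ (trans (cong isDist (f≗f′ Y)) d) in
      (λ {Y′} q → trans (cong isDist (sym (f≗f′ Y′))) (L-core q)) ,
      (λ {G′} q → trans (cong isDist (sym (h≗h′ (Y ⊕ G′)))) (L-G q))

    winning-resp : ∀ {l} {f f′ h h′ : Game → 𝒯 (suc l)} → f ≗ f′ → h ≗ h′ → WinningRuleFor f h → WinningRuleFor f′ h′
    winning-resp f≗f′ h≗h′ W {Y} Y∈ d with W Y∈ (trans (cong isDist (f≗f′ Y)) d)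
    ... | inj₁ (Y′ , q , dY′) = inj₁ (Y′ , q , trans (cong isDist (sym (f≗f′ Y′))) dY′)
    ... | inj₂ (G′ , q , dG′) = inj₂ (G′ , q , trans (cong isDist (sym (h≗h′ (Y ⊕ G′)))) dG′)

    module Extension {l} {e : 𝒯 (suc n) → 𝒯 (suc l)} (e-emb : IsEmbedding e) (g : 𝒯 (suc l)) where
      open IsEmbedding e-emb

      τ : Game → ℕ → 𝒯 (suc l)
      τ Y k = e (φ Y) · g ^ᵀ k

      value : ∀ {X} → Decomposition X → 𝒯 (suc l)
      value (decomposition Y k _ _) = τ Y k

      value-𝒜 : ∀ {Y} (Y∈ : 𝒜 Y) → value (decomposition-𝒜 Y∈) ≡ e (φ Y)
      value-𝒜 {Y} _ = ·-identityʳ (e (φ Y))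

      value-G : value decomposition-G ≡ g
      value-G = begin
        e (φ 𝟘) · (g · one)  ≡⟨ cong (λ t → e t · (g · one)) hom-zero ⟩
        e one · (g · one)    ≡⟨ cong (_· (g · one)) e-one ⟩
        g · one              ≡⟨ ·-identityʳ g ⟩
        g                    ∎

      value-⊕ : ∀ {X₁ X₂} (d₁ : Decomposition X₁) (d₂ : Decomposition X₂)
              → value (decomposition-⊕ d₁ d₂) ≡ value d₁ · value d₂
      value-⊕ (decomposition Y₁ k₁ Y₁∈ _) (decomposition Y₂ k₂ Y₂∈ _) = begin
        e (φ (Y₁ ⊕ Y₂)) · g ^ᵀ (k₁ + k₂)
          ≡⟨ cong₂ _·_ (trans (cong e (hom-sum Y₁∈ Y₂∈)) (e-· (φ Y₁) (φ Y₂))) (^ᵀ-+ g k₁ k₂) ⟩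
        (e (φ Y₁) · e (φ Y₂)) · (g ^ᵀ k₁ · g ^ᵀ k₂)
          ≡⟨ ·-interchange (e (φ Y₁)) (e (φ Y₂)) (g ^ᵀ k₁) (g ^ᵀ k₂) ⟩
        (e (φ Y₁) · g ^ᵀ k₁) · (e (φ Y₂) · g ^ᵀ k₂)
          ∎

      LosingRule : Set
      LosingRule = ∀ j → LosingRuleFor (λ Y → τ Y (suc j)) (λ Y → τ Y j)

      WinningRule : Set
      WinningRule = ∀ j → WinningRuleFor (λ Y → τ Y (suc j)) (λ Y → τ Y j)

      OutcomeFormula : Set
      OutcomeFormula = ∀ {X} (d : Decomposition X) → isP X ≡ isDist (value d)

      outcome-formula : ∃ (_isOptionOf G) → LosingRule → WinningRule → OutcomeFormula
      outcome-formula (_ , G₀∈) losing winning = go (isOptionOf-wellFounded _)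
        where
        go : ∀ {X} → Acc _isOptionOf_ X → (d : Decomposition X) → isP X ≡ isDist (value d)
        go {X} _ (decomposition Y zero Y∈ X≈) = begin
          isP X                   ≡⟨ isP-resp-≈ X≈ ⟩
          isP (Y ⊕ 𝟘)             ≡⟨ cong isP (⊕-identityʳ Y) ⟩
          isP Y                   ≡⟨ isP≡isDist∘φ Y∈ ⟩
          isDist (φ Y)            ≡⟨ isDist-e (φ Y) ⟨
          isDist (e (φ Y))        ≡⟨ cong isDist (·-identityʳ (e (φ Y))) ⟨
          isDist (e (φ Y) · one)  ∎
        go {X} (acc rs) (decomposition Y (suc j) Y∈ X≈) with isDist (τ Y (suc j)) in d
        ... | true = P-intro X (proj₁ (proj₂ (option-via-G {j = j} X≈ G₀∈))) options-N
          where
          options-N : ∀ {x} → x isOptionOf X → isP x ≡ false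
          options-N p with options-split {k = suc j} X≈ p
          ... | inj₁ (Y′ , q , x≈) =
                trans (go (rs p) (decomposition Y′ (suc j) (opt-closed Y∈ q) x≈)) (proj₁ (losing j Y∈ d) q)
          ... | inj₂ (_ , refl , G′ , q , x≈) =
                trans (go (rs p) (decomposition (Y ⊕ G′) j (sum-closed Y∈ (G-options q)) x≈)) (proj₂ (losing j Y∈ d) q)
        ... | false with winning j Y∈ d
        ...   | inj₁ (Y′ , q , dY′) = let (x , p , x≈) = option-via-core {k = suc j} X≈ q in
                N-intro X p (trans (go (rs p) (decomposition Y′ (suc j) (opt-closed Y∈ q) x≈)) dY′)
        ...   | inj₂ (G′ , q , dG′) = let (x , p , x≈) = option-via-G {j = j} X≈ q in
                N-intro X p (trans (go (rs p) (decomposition (Y ⊕ G′) j (sum-closed Y∈ (G-options q)) x≈)) dG′)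

      record Representative (t : 𝒯 (suc l)) : Set where
        field
          game : Game
          ∈ℬ : ℬ game
          split : Decomposition game
          value≡ : value split ≡ t

      Representatives : Set
      Representatives = ∀ t → Representative t

      representative-𝒜 : ∀ t → Representative (e t)
      representative-𝒜 t = record
        { game = rep𝒜 t ; ∈ℬ = base (inj₁ (rep𝒜∈𝒜 t)) ; split = decomposition-𝒜 (rep𝒜∈𝒜 t)
        ; value≡ = trans (value-𝒜 (rep𝒜∈𝒜 t)) (cong e (φ-rep𝒜 t)) }

      Extends : Set
      Extends = Σ (Game → 𝒯 (suc l)) λ ψ → IsQuotientIso ℬ ψ × (∀ {Y} → 𝒜 Y → ψ Y ≡ e (φ Y)) × ψ G ≡ g

      -- ψ X is the class whose translates by s are distinguished exactly when X + rep s is a P-position.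
      module Classification (formula : OutcomeFormula) (R : Representatives) where
        rep : 𝒯 (suc l) → Game
        rep t = Representative.game (R t)

        signature : Game → List Bool
        signature X = map (λ s → isP (X ⊕ rep s)) (all𝒯 (suc l))

        signatureᵀ : 𝒯 (suc l) → List Bool
        signatureᵀ t = map (λ s → isDist (t · s)) (all𝒯 (suc l))

        signatureᵀ-injective : ∀ {t u} → signatureᵀ t ≡ signatureᵀ u → t ≡ u
        signatureᵀ-injective eq = ·-reduced _ _ λ s → map-pointwise (all𝒯 (suc l)) eq (∈-all𝒯 s)
          where
          map-pointwise : ∀ {f h : 𝒯 (suc l) → Bool} xs → map f xs ≡ map h xs → ∀ {x} → x ∈ xs → f x ≡ h x
          map-pointwise (x ∷ xs) eq (here refl) = proj₁ (∷-injective eq)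
          map-pointwise (x ∷ xs) eq (there p) = map-pointwise xs (proj₂ (∷-injective eq)) p

        select : List (𝒯 (suc l)) → List Bool → 𝒯 (suc l)
        select [] _ = one
        select (t ∷ ts) bs with ≡-dec _≟ᴮ_ (signatureᵀ t) bs
        ... | yes _ = t
        ... | no _ = select ts bs

        select-signature : ∀ ts bs {t} → t ∈ ts → signatureᵀ t ≡ bs → signatureᵀ (select ts bs) ≡ bs
        select-signature (u ∷ ts) bs p eq with ≡-dec _≟ᴮ_ (signatureᵀ u) bs
        ... | yes eq′ = eq′
        ... | no neq with p
        ...   | here refl = ⊥-elim (neq eq)
        ...   | there p′ = select-signature ts bs p′ eq

        ψ : Game → 𝒯 (suc l)
        ψ X = select (all𝒯 (suc l)) (signature X)

        signature-value : ∀ {X} (d : Decomposition X) → signature X ≡ signatureᵀ (value d)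
        signature-value d = map-cong (λ s → trans (formula (decomposition-⊕ d (Representative.split (R s))))
          (cong isDist (trans (value-⊕ d (Representative.split (R s))) (cong (value d ·_) (Representative.value≡ (R s)))))) (all𝒯 (suc l))

        ψ-value : ∀ {X} (d : Decomposition X) → ψ X ≡ value d
        ψ-value d = signatureᵀ-injective
          (trans (select-signature _ _ (∈-all𝒯 (value d)) (sym (signature-value d))) (signature-value d))

        ψ-⊕ : ∀ {X Y} → ℬ X → ℬ Y → ψ (X ⊕ Y) ≡ ψ X · ψ Y
        ψ-⊕ BX BY = let dX = decompose BX ; dY = decompose BY in
          trans (ψ-value (decomposition-⊕ dX dY)) (trans (value-⊕ dX dY) (sym (cong₂ _·_ (ψ-value dX) (ψ-value dY))))

        isP≡isDist∘ψ : ∀ {X} → ℬ X → isP X ≡ isDist (ψ X)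
        isP≡isDist∘ψ BX = trans (formula (decompose BX)) (cong isDist (sym (ψ-value (decompose BX))))

        ψ-injective : ∀ {X Y} → ℬ X → ℬ Y → ψ X ≡ ψ Y → X ≡[ ℬ ] Y
        ψ-injective {X} {Y} BX BY ψX≡ψY Z BZ = begin
          isP (X ⊕ Z)          ≡⟨ isP≡isDist∘ψ (sum∈ BX BZ) ⟩
          isDist (ψ (X ⊕ Z))   ≡⟨ cong isDist (ψ-⊕ BX BZ) ⟩
          isDist (ψ X · ψ Z)   ≡⟨ cong (λ t → isDist (t · ψ Z)) ψX≡ψY ⟩
          isDist (ψ Y · ψ Z)   ≡⟨ cong isDist (ψ-⊕ BY BZ) ⟨
          isDist (ψ (Y ⊕ Z))   ≡⟨ isP≡isDist∘ψ (sum∈ BY BZ) ⟨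
          isP (Y ⊕ Z)          ∎

        ψ-iso : IsQuotientIso ℬ ψ
        ψ-iso = record
          { well-defined = λ _ _ X≡Y → cong (select (all𝒯 (suc l))) (map-cong (λ s → X≡Y (rep s) (Representative.∈ℬ (R s))) (all𝒯 (suc l)))
          ; injective = ψ-injective
          ; surjective = λ t → let open Representative (R t) in game , ∈ℬ , trans (ψ-value split) value≡
          ; hom-zero = trans (ψ-value (decomposition-𝒜 has-zero)) (trans (value-𝒜 has-zero) (trans (cong e hom-zero) e-one))
          ; hom-sum = ψ-⊕
          ; dist-to = λ BX PX → Equivalence.to isDist⇔Dist (trans (sym (isP≡isDist∘ψ BX)) PX)
          ; dist-from = λ BX d → trans (isP≡isDist∘ψ BX) (Equivalence.from isDist⇔Dist d)
          }

      extension : ∃ (_isOptionOf G) → LosingRule → WinningRule → Representatives → Extends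
      extension G-option losing winning R = ψ , ψ-iso , (λ Y∈ → trans (ψ-value (decomposition-𝒜 Y∈)) (value-𝒜 Y∈))
                                            , trans (ψ-value decomposition-G) value-G
        where
        open Classification (outcome-formula G-option losing winning) R

    Δ≐-singleton : ∀ {t u G′} → Δ≐ φ G (t ∷ []) → G′ isOptionOf G → φ G′ ≡ u → InFour u → u ≡ t
    Δ≐-singleton Δ q refl four with Δ≐⇒∈ Δ four (option⇒∈Φ''G q)
    ... | here u≡t = u≡t

    module SingletonA (Δ≐a : Δ≐ φ G (a ∷ [])) where
      open Extension id-isEmbedding one

      options-outside : ∀ {G′} → G′ isOptionOf G → ¬ (φ G′ ≡ one ⊎ φ G′ ≡ z₀ ⊎ φ G′ ≡ z₁)
      options-outside q (inj₁ e) with Δ≐-singleton Δ≐a q e four-one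
      ... | ()
      options-outside q (inj₂ (inj₁ e)) with Δ≐-singleton Δ≐a q e four-z
      ... | ()
      options-outside q (inj₂ (inj₂ e)) with Δ≐-singleton Δ≐a q e four-az
      ... | ()

      losing : LosingRuleFor φ φ
      losing {Y} Y∈ dY =
        isDist∘φ-options Y∈ dY ,
        (λ {G′} q → trans (cong isDist (hom-sum Y∈ (G-options q)))
                      (¬-not λ d → options-outside q (isDist-·-isDist⇒ (φ Y) (φ G′) dY d)))

      winning : WinningRuleFor φ φ
      winning {Y} Y∈ dY with ¬isDist∘φ-elim Y∈ dY
      ... | inj₂ Y′-move = inj₁ Y′-move
      ... | inj₁ refl = let (Gₐ , q , φGₐ≡a) = find (Δ≐⇒∈Φ''G Δ≐a (here refl)) in
            inj₂ (Gₐ , q , cong isDist (trans (hom-sum Y∈ (G-options q)) (cong₂ _·_ hom-zero φGₐ≡a)))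

      φ≗τ : ∀ j → φ ≗ (λ Y → τ Y j)
      φ≗τ j Y = sym (trans (cong (φ Y ·_) (one-^ᵀ j)) (·-identityʳ (φ Y)))

      extends : ∃ (_isOptionOf G) → Extends
      extends G-option = extension G-option
        (λ j → losing-resp (φ≗τ (suc j)) (φ≗τ j) losing)
        (λ j → winning-resp (φ≗τ (suc j)) (φ≗τ j) winning)
        representative-𝒜

    module Singleton1 (Δ≐1 : Δ≐ φ G (one ∷ [])) where
      open Extension id-isEmbedding a

      options-outside : ∀ {G′} → G′ isOptionOf G → ¬ (φ G′ ≡ a ⊎ φ G′ ≡ z₁ ⊎ φ G′ ≡ z₀)
      options-outside q (inj₁ e) with Δ≐-singleton Δ≐1 q e four-a
      ... | ()
      options-outside q (inj₂ (inj₁ e)) with Δ≐-singleton Δ≐1 q e four-az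
      ... | ()
      options-outside q (inj₂ (inj₂ e)) with Δ≐-singleton Δ≐1 q e four-z
      ... | ()

      -- a · φ G′ avoids {1, z, az} because φ G′ avoids a · {1, z, az} = {a, az, z}.
      no-partner : ∀ {G′} → G′ isOptionOf G → ∀ t → isDist t ≡ true → isDist (t · (a · φ G′)) ≡ false
      no-partner {G′} q t dt = ¬-not λ d → options-outside q (translate (isDist-·-isDist⇒ t (a · φ G′) dt d))
        where
        untranslate : ∀ {u} → a · φ G′ ≡ u → φ G′ ≡ a · u
        untranslate eq = trans (sym (a·a· (φ G′))) (cong (a ·_) eq)
        translate : a · φ G′ ≡ one ⊎ a · φ G′ ≡ z₀ ⊎ a · φ G′ ≡ z₁ → φ G′ ≡ a ⊎ φ G′ ≡ z₁ ⊎ φ G′ ≡ z₀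
        translate (inj₁ eq) = inj₁ (untranslate eq)
        translate (inj₂ (inj₁ eq)) = inj₂ (inj₁ (untranslate eq))
        translate (inj₂ (inj₂ eq)) = inj₂ (inj₂ (untranslate eq))

      losing-even : LosingRuleFor φ (λ X → φ X · a)
      losing-even {Y} Y∈ dY =
        isDist∘φ-options Y∈ dY ,
        (λ {G′} q → trans (cong isDist (regroup (φ Y) (φ G′) (hom-sum Y∈ (G-options q)))) (no-partner q (φ Y) dY))
        where
        regroup : ∀ t γ {u} → u ≡ t · γ → u · a ≡ t · (a · γ)
        regroup t γ refl = trans (·-assoc t γ a) (cong (t ·_) (·-comm γ a))

      losing-odd : LosingRuleFor (λ Y → φ Y · a) φ
      losing-odd {Y} Y∈ dY =
        (λ {Y′} q → trans (sym (isP-⊕W (opt-closed Y∈ q))) (P⇒options-N (Y ⊕ W) (trans (isP-⊕W Y∈) dY) (⊕-optionˡ Y W q))) ,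
        (λ {G′} q → trans (cong isDist (regroup (φ Y) (φ G′) (hom-sum Y∈ (G-options q)))) (no-partner q (φ Y · a) dY))
        where
        regroup : ∀ t γ {u} → u ≡ t · γ → u ≡ (t · a) · (a · γ)
        regroup t γ refl = trans (cong (t ·_) (sym (a·a· γ))) (sym (·-assoc t a (a · γ)))

      G₁ : ∃ λ G′ → G′ isOptionOf G × φ G′ ≡ one
      G₁ = find (Δ≐⇒∈Φ''G Δ≐1 (here refl))

      winning-even : WinningRuleFor φ (λ X → φ X · a)
      winning-even {Y} Y∈ dY with ¬isDist∘φ-elim Y∈ dY
      ... | inj₂ Y′-move = inj₁ Y′-move
      ... | inj₁ refl = let (G′ , q , φG′≡one) = G₁ in
            inj₂ (G′ , q , cong (λ t → isDist (t · a)) (trans (hom-sum Y∈ (G-options q)) (cong₂ _·_ hom-zero φG′≡one)))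

      winning-odd : WinningRuleFor (λ Y → φ Y · a) φ
      winning-odd {Y} Y∈ dY with isDist (φ Y) in dφY
      ... | true = let (G′ , q , φG′≡one) = G₁ in
            inj₂ (G′ , q , trans (cong isDist (trans (hom-sum Y∈ (G-options q)) (trans (cong (φ Y ·_) φG′≡one) (·-identityʳ (φ Y))))) dφY)
      ... | false = inj₁ (¬isDist-·a-elim Y∈ dφY dY)

      parity : ∀ j → (φ ≗ (λ Y → τ Y (suc j)) × (λ X → φ X · a) ≗ (λ X → τ X j))
                   ⊎ ((λ Y → φ Y · a) ≗ (λ Y → τ Y (suc j)) × φ ≗ (λ X → τ X j))
      parity j with a-^ᵀ j
      ... | inj₁ aʲ≡a = inj₁ ((λ Y → sym (trans (cong (λ t → φ Y · (a · t)) aʲ≡a) (·-identityʳ (φ Y))))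
                             , (λ X → cong (φ X ·_) (sym aʲ≡a)))
      ... | inj₂ aʲ≡one = inj₂ ((λ Y → cong (λ t → φ Y · (a · t)) (sym aʲ≡one))
                               , (λ X → sym (trans (cong (φ X ·_) aʲ≡one) (·-identityʳ (φ X)))))

      extends : ∃ (_isOptionOf G) → Extends
      extends G-option = extension G-option losing winning representative-𝒜
        where
        losing : LosingRule
        losing j with parity j
        ... | inj₁ (f≗ , h≗) = losing-resp f≗ h≗ losing-even
        ... | inj₂ (f≗ , h≗) = losing-resp f≗ h≗ losing-odd
        winning : WinningRule
        winning j with parity j
        ... | inj₁ (f≗ , h≗) = winning-resp f≗ h≗ winning-even
        ... | inj₂ (f≗ , h≗) = winning-resp f≗ h≗ winning-odd

    module Generic (tame : Tame φ G) (Δ≢a : ¬ Δ≐ φ G (a ∷ [])) (Δ≢1 : ¬ Δ≐ φ G (one ∷ []))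
                   {l} {e : 𝒯 (suc n) → 𝒯 (suc l)} (e-emb : IsEmbedding e)
                   (c : Bits (suc l)) (val-c : val c ≡ grundy G) where
      open Tameness tame Δ≢a Δ≢1
      open IsEmbedding e-emb
      open Extension e-emb (z c)

      β : Game → Bits (suc l)
      β Y = bits (e (φ Y))

      grundy≡val∘β : ∀ {Y} → 𝒜 Y → grundy Y ≡ val (β Y)
      grundy≡val∘β {Y} Y∈ = trans (grundy≡index∘φ Y∈) (sym (index-e (φ Y)))

      grundy≡⇒β≡ : ∀ {Y Y′} → 𝒜 Y → 𝒜 Y′ → grundy Y ≡ grundy Y′ → β Y ≡ β Y′
      grundy≡⇒β≡ Y∈ Y′∈ eq = val-injective _ _ (trans (sym (grundy≡val∘β Y∈)) (trans eq (grundy≡val∘β Y′∈)))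

      β-⊕ : ∀ {Y G′} → 𝒜 Y → 𝒜 G′ → β (Y ⊕ G′) ≡ β Y ⊻ β G′
      β-⊕ {Y} {G′} Y∈ G′∈ =
        trans (cong (λ t → bits (e t)) (hom-sum Y∈ G′∈)) (trans (cong bits (e-· (φ Y) (φ G′))) (bits-· (e (φ Y)) (e (φ G′))))

      powBits : ℕ → Bits (suc l)
      powBits j = bits (z c ^ᵀ j)

      powBits-suc : ∀ j → powBits (suc j) ≡ c ⊻ powBits j
      powBits-suc j = bits-· (z c) (z c ^ᵀ j)

      powBits-cases : ∀ j → powBits j ≡ 0s × powBits (suc j) ≡ c ⊎ powBits j ≡ c × powBits (suc j) ≡ 0s
      powBits-cases zero = inj₁ (refl , refl)
      powBits-cases (suc j) with powBits-cases j
      ... | inj₁ (_ , P₁≡c) = inj₂ (P₁≡c , trans (powBits-suc (suc j)) (trans (cong (c ⊻_) P₁≡c) (⊻-self c)))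
      ... | inj₂ (_ , P₁≡0s) = inj₁ (P₁≡0s , trans (powBits-suc (suc j)) (trans (cong (c ⊻_) P₁≡0s) (⊻-identityʳ c)))

      isDist-τ-suc⇔ : ∀ Y j → isDist (τ Y (suc j)) ≡ true ⇔ β Y ≡ powBits (suc j)
      isDist-τ-suc⇔ Y j = subst (λ t → isDist (e (φ Y) · t) ≡ true ⇔ β Y ≡ powBits (suc j)) (sym z-power)
                                (isDist-·z⇔ (e (φ Y)) (powBits (suc j)))
        where
        z-power : z c ^ᵀ suc j ≡ z (powBits (suc j))
        z-power = isZ-bits-injective (isZ-· (z c) (z c ^ᵀ j)) refl

      isDist-τ-zero : ∀ {Y G′} → 𝒜 Y → 𝒜 G′ → isDist (τ (Y ⊕ G′) 0) ≡ isDist (φ Y · φ G′)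
      isDist-τ-zero {Y} {G′} Y∈ G′∈ = begin
        isDist (e (φ (Y ⊕ G′)) · one)  ≡⟨ cong isDist (·-identityʳ (e (φ (Y ⊕ G′)))) ⟩
        isDist (e (φ (Y ⊕ G′)))        ≡⟨ isDist-e (φ (Y ⊕ G′)) ⟩
        isDist (φ (Y ⊕ G′))            ≡⟨ cong isDist (hom-sum Y∈ G′∈) ⟩
        isDist (φ Y · φ G′)            ∎

      β-option≢c : ∀ {G′} → G′ isOptionOf G → β G′ ≢ c
      β-option≢c q βG′≡c =
        grundy-option≢ G q (trans (grundy≡val∘β (G-options q)) (trans (cong val βG′≡c) val-c))

      losing-core : ∀ {Y} j → 𝒜 Y → β Y ≡ powBits (suc j) → ∀ {Y′} → Y′ isOptionOf Y → isDist (τ Y′ (suc j)) ≡ false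
      losing-core {Y} j Y∈ βY {Y′} q = ¬-not λ d → grundy-option≢ Y q
        (trans (grundy≡val∘β (opt-closed Y∈ q))
          (trans (cong val (trans (Equivalence.to (isDist-τ-suc⇔ Y′ j) d) (sym βY))) (sym (grundy≡val∘β Y∈))))

      losing-G-suc : ∀ {Y} i → 𝒜 Y → β Y ≡ powBits (suc (suc i)) → ∀ {G′} → G′ isOptionOf G
                   → isDist (τ (Y ⊕ G′) (suc i)) ≡ false
      losing-G-suc {Y} i Y∈ βY {G′} q = ¬-not λ d → β-option≢c q (begin
        β G′                        ≡⟨ ⊻-cancelˡ (β Y) (β G′) ⟨
        β Y ⊻ (β Y ⊻ β G′)          ≡⟨ cong (β Y ⊻_) (trans (sym (β-⊕ Y∈ (G-options q))) (Equivalence.to (isDist-τ-suc⇔ (Y ⊕ G′) i) d)) ⟩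
        β Y ⊻ powBits (suc i)             ≡⟨ cong (_⊻ powBits (suc i)) (trans βY (powBits-suc (suc i))) ⟩
        (c ⊻ powBits (suc i)) ⊻ powBits (suc i) ≡⟨ ⊻-cancelʳ c (powBits (suc i)) ⟩
        c                           ∎)

      -- Here index (φ Y) = grundy G, which makes the exceptional products 1 · a and a · 1 contradict tameness.
      losing-G-zero : ∀ {Y} → 𝒜 Y → β Y ≡ c → ∀ {G′} → G′ isOptionOf G → isDist (τ (Y ⊕ G′) 0) ≡ false
      losing-G-zero {Y} Y∈ βY {G′} q = ¬-not λ d → impossible (isDist-·⇒ (φ Y) (φ G′) (trans (sym (isDist-τ-zero Y∈ (G-options q))) d))
        where
        index-φY : index (φ Y) ≡ grundy G
        index-φY = trans (sym (index-e (φ Y))) (trans (cong val βY) val-c)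
        φG′∈ : φ G′ ∈Φ''G
        φG′∈ = option⇒∈Φ''G q
        impossible : bits (φ Y) ≡ bits (φ G′) ⊎ (φ Y ≡ one × φ G′ ≡ a) ⊎ (φ Y ≡ a × φ G′ ≡ one) → ⊥
        impossible (inj₁ bits≡) = grundy-option≢ G q (trans (grundy≡index∘φ (G-options q)) (trans (cong val (sym bits≡)) index-φY))
        impossible (inj₂ (inj₁ (φY≡one , φG′≡a))) =
          let index-z≡m = trans (cong index (sym φY≡one)) index-φY in
          index≡grundy⇒∉Φ''G z₀ index-z≡m
            (proj₁ (a∈Δ⇒z,az∈Δ (subst _∈Φ''G φG′≡a φG′∈) (index≡grundy⇒∉Φ''G one index-z≡m)))
        impossible (inj₂ (inj₂ (φY≡a , φG′≡one))) =
          let index-az≡m = trans (cong index (sym φY≡a)) index-φY in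
          index≡grundy⇒∉Φ''G z₁ index-az≡m
            (proj₂ (one∈Δ⇒z,az∈Δ (subst _∈Φ''G φG′≡one φG′∈) (index≡grundy⇒∉Φ''G a index-az≡m)))

      losing : LosingRule
      losing j {Y} Y∈ d = losing-core j Y∈ βY , losing-G j βY
        where
        βY : β Y ≡ powBits (suc j)
        βY = Equivalence.to (isDist-τ-suc⇔ Y j) d
        losing-G : ∀ j → β Y ≡ powBits (suc j) → ∀ {G′} → G′ isOptionOf G → isDist (τ (Y ⊕ G′) j) ≡ false
        losing-G zero βY = losing-G-zero Y∈ βY
        losing-G (suc i) βY = losing-G-suc i Y∈ βY

      move-into : ∀ {Y t} → 𝒜 Y → t ∈Φ''G → isDist (φ Y · t) ≡ true
                → ∃ λ G′ → G′ isOptionOf G × isDist (τ (Y ⊕ G′) 0) ≡ true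
      move-into {Y} Y∈ t∈ d = let (G′ , q , φG′≡t) = find t∈ in
        G′ , q , trans (isDist-τ-zero Y∈ (G-options q)) (trans (cong (λ u → isDist (φ Y · u)) φG′≡t) d)

      answer-one : ∀ {Y} → 𝒜 Y → φ Y ≡ one → one ∈Φ''G → ∃ λ G′ → G′ isOptionOf G × isDist (τ (Y ⊕ G′) 0) ≡ true
      answer-one Y∈ φY≡one 1∈ with a ∈Φ''G?
      ... | yes a∈ = move-into Y∈ a∈ (cong (λ t → isDist (t · a)) φY≡one)
      ... | no a∉ = move-into Y∈ (proj₁ (one∈Δ⇒z,az∈Δ 1∈ a∉)) (trans (cong (λ t → isDist (t · z₀)) φY≡one) (allFalse-0s (suc n)))

      answer-a : ∀ {Y} → 𝒜 Y → φ Y ≡ a → a ∈Φ''G → ∃ λ G′ → G′ isOptionOf G × isDist (τ (Y ⊕ G′) 0) ≡ true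
      answer-a Y∈ φY≡a a∈ with one ∈Φ''G?
      ... | yes 1∈ = move-into Y∈ 1∈ (cong (λ t → isDist (t · one)) φY≡a)
      ... | no 1∉ = move-into Y∈ (proj₂ (a∈Δ⇒z,az∈Δ a∈ 1∉)) (trans (cong (λ t → isDist (t · z₁)) φY≡a) (allFalse-0s n))

      mirror : ∀ {Y G′} j → powBits j ≡ 0s → 𝒜 Y → G′ isOptionOf G → grundy Y ≡ grundy G′
             → ∃ λ G″ → G″ isOptionOf G × isDist (τ (Y ⊕ G″) j) ≡ true
      mirror {Y} {G′} (suc i) Pj≡0s Y∈ q eq = G′ , q , Equivalence.from (isDist-τ-suc⇔ (Y ⊕ G′) i) (begin
        β (Y ⊕ G′)    ≡⟨ β-⊕ Y∈ (G-options q) ⟩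
        β Y ⊻ β G′    ≡⟨ cong (_⊻ β G′) (grundy≡⇒β≡ Y∈ (G-options q) eq) ⟩
        β G′ ⊻ β G′   ≡⟨ ⊻-self (β G′) ⟩
        0s            ≡⟨ Pj≡0s ⟨
        powBits (suc i)     ∎)
      mirror {Y} {G′} zero _ Y∈ q eq with bits≡⇒isDist-· (φ Y) (φ G′)
        (val-injective _ _ (trans (sym (grundy≡index∘φ Y∈)) (trans eq (grundy≡index∘φ (G-options q)))))
      ... | inj₁ d = move-into Y∈ (option⇒∈Φ''G q) d
      ... | inj₂ (inj₁ (φY≡one , φG′≡one)) = answer-one Y∈ φY≡one (subst _∈Φ''G φG′≡one (option⇒∈Φ''G q))
      ... | inj₂ (inj₂ (φY≡a , φG′≡a)) = answer-a Y∈ φY≡a (subst _∈Φ''G φG′≡a (option⇒∈Φ''G q))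

      winning : WinningRule
      winning j {Y} Y∈ d with <-cmp (grundy Y) (val (powBits (suc j)))
      ... | tri≈ _ eq _ = ⊥-elim (false≢true (trans (sym d) (Equivalence.from (isDist-τ-suc⇔ Y j)
              (val-injective _ _ (trans (sym (grundy≡val∘β Y∈)) eq)))))
      ... | tri> _ _ gY> = let (Y′ , q , gY′) = grundy-option-below Y gY> in
            inj₁ (Y′ , q , Equivalence.from (isDist-τ-suc⇔ Y′ j)
              (val-injective _ _ (trans (sym (grundy≡val∘β (opt-closed Y∈ q))) gY′)))
      ... | tri< gY< _ _ with powBits-cases j
      ...   | inj₂ (_ , P₁≡0s) = ⊥-elim (n≮0 (subst (grundy Y <_) (trans (cong val P₁≡0s) (val-0s (suc l))) gY<))
      ...   | inj₁ (Pj≡0s , P₁≡c) =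
              let (G′ , q , gG′) = grundy-option-below G (subst (grundy Y <_) (trans (cong val P₁≡c) val-c) gY<) in
              inj₂ (mirror j Pj≡0s Y∈ q (sym gG′))

      extends : ∃ (_isOptionOf G) → Representatives → Extends
      extends G-option = extension G-option losing winning

    module Doubling where
      open Extension embed-isEmbedding (z (0s ∷ʳ true))

      -- z_i with i ≥ 2^(n+1) is the class of (a game in z_(i - 2^(n+1))) + G.
      representatives : Representatives
      representatives one = representative-𝒜 one
      representatives a = representative-𝒜 a
      representatives (z w) with initLast w
      ... | v , false , refl = representative-𝒜 (z v)
      ... | v , true , refl = record
        { game = rep𝒜 (z v) ⊕ G
        ; ∈ℬ = sum∈ (base (inj₁ (rep𝒜∈𝒜 (z v)))) (base (inj₂ refl))
        ; split = decomposition-⊕ (decomposition-𝒜 (rep𝒜∈𝒜 (z v))) decomposition-G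
        ; value≡ = begin
            value (decomposition-⊕ (decomposition-𝒜 (rep𝒜∈𝒜 (z v))) decomposition-G)
              ≡⟨ value-⊕ (decomposition-𝒜 (rep𝒜∈𝒜 (z v))) decomposition-G ⟩
            value (decomposition-𝒜 (rep𝒜∈𝒜 (z v))) · value decomposition-G
              ≡⟨ cong₂ _·_ (trans (value-𝒜 (rep𝒜∈𝒜 (z v))) (cong embed (φ-rep𝒜 (z v)))) value-G ⟩
            z (v ∷ʳ false) · z (0s ∷ʳ true)
              ≡⟨ cong z (trans (⊻-∷ʳ v 0s false true) (cong (_∷ʳ true) (⊻-identityʳ v))) ⟩
            z (v ∷ʳ true)
              ∎
        }

    Δ≐-singleton⇒¬j<grundy : ∀ {t} j → Δ≐ φ G (t ∷ []) → (∀ u → index u ≡ j → InFour u × u ≢ t) → ¬ j < grundy G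
    Δ≐-singleton⇒¬j<grundy j Δ classes j<m =
      let (G′ , q , gG′≡j) = grundy-option-below G j<m
          (four , φG′≢t) = classes (φ G′) (trans (sym (grundy≡index∘φ (G-options q))) gG′≡j) in
      φG′≢t (Δ≐-singleton Δ q refl four)

    Δ≐a⇒¬0<grundy : Δ≐ φ G (a ∷ []) → ¬ 0 < grundy G
    Δ≐a⇒¬0<grundy Δ = Δ≐-singleton⇒¬j<grundy 0 Δ λ u iu≡0 → classes (index≡0⇒ u iu≡0)
      where
      classes : ∀ {u} → u ≡ one ⊎ u ≡ z₀ → InFour u × u ≢ a
      classes (inj₁ refl) = four-one , λ ()
      classes (inj₂ refl) = four-z , λ ()

    Δ≐1⇒¬1<grundy : Δ≐ φ G (one ∷ []) → ¬ 1 < grundy G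
    Δ≐1⇒¬1<grundy Δ = Δ≐-singleton⇒¬j<grundy 1 Δ λ u iu≡1 → classes (index≡1⇒ u iu≡1)
      where
      classes : ∀ {u} → u ≡ a ⊎ u ≡ z₁ → InFour u × u ≢ one
      classes (inj₁ refl) = four-a , λ ()
      classes (inj₂ refl) = four-az , λ ()

    Δ≐a⇒¬Δ≐1 : Δ≐ φ G (a ∷ []) → ¬ Δ≐ φ G (one ∷ [])
    Δ≐a⇒¬Δ≐1 Δa Δ1 with Δ≐⇒∈ Δ1 four-a (Δ≐⇒∈Φ''G Δa (here refl))
    ... | here ()
    ... | there ()

    module Main (G-option : ∃ (_isOptionOf G)) (tame : Tame φ G) where

      Result : ∀ {l} → (𝒯 (suc n) → 𝒯 (suc l)) → Set
      Result {l} e = Σ (Game → 𝒯 (suc l)) λ ψ → IsQuotientIso ℬ ψ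
                   × (∀ {Y} → 𝒜 Y → ψ Y ≡ e (φ Y))
                   × (Δ≐ φ G (a ∷ []) → ψ G ≡ one)
                   × (Δ≐ φ G (one ∷ []) → ψ G ≡ a)
                   × (¬ Δ≐ φ G (a ∷ []) → ¬ Δ≐ φ G (one ∷ []) → Σ (Bits (suc l)) λ i → ψ G ≡ z i × val i ≡ grundy G)

      small : grundy G < 2 ^ suc n → Result (λ x → x)
      small m< with Δ≐? (a ∷ []) | Δ≐? (one ∷ [])
      ... | yes Δa | _ = let (ψ , ψ-iso , ψ-𝒜 , ψG≡one) = SingletonA.extends Δa G-option in
            ψ , ψ-iso , ψ-𝒜 , (λ _ → ψG≡one) , (λ Δ1 → ⊥-elim (Δ≐a⇒¬Δ≐1 Δa Δ1)) , (λ ¬Δa _ → ⊥-elim (¬Δa Δa))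
      ... | no ¬Δa | yes Δ1 = let (ψ , ψ-iso , ψ-𝒜 , ψG≡a) = Singleton1.extends Δ1 G-option in
            ψ , ψ-iso , ψ-𝒜 , (λ Δa → ⊥-elim (¬Δa Δa)) , (λ _ → ψG≡a) , (λ _ ¬Δ1 → ⊥-elim (¬Δ1 Δ1))
      ... | no ¬Δa | no ¬Δ1 =
            let (c , val-c) = val-surjective (suc n) m<
                (ψ , ψ-iso , ψ-𝒜 , ψG≡zc) = Generic.extends tame ¬Δa ¬Δ1 id-isEmbedding c val-c G-option
                                              (Extension.representative-𝒜 id-isEmbedding (z c)) in
            ψ , ψ-iso , ψ-𝒜 , (λ Δa → ⊥-elim (¬Δa Δa)) , (λ Δ1 → ⊥-elim (¬Δ1 Δ1)) , (λ _ _ → c , ψG≡zc , val-c)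

      large : grundy G ≡ 2 ^ suc n → Result embed
      large m≡ with Δ≐? (a ∷ []) | Δ≐? (one ∷ [])
      ... | yes Δa | _ = ⊥-elim (Δ≐a⇒¬0<grundy Δa (subst (0 <_) (sym m≡) (m^n>0 2 (suc n))))
      ... | no _ | yes Δ1 = ⊥-elim (Δ≐1⇒¬1<grundy Δ1 (subst (1 <_) (sym m≡) (*-monoʳ-≤ 2 (m^n>0 2 n))))
      ... | no ¬Δa | no ¬Δ1 =
            let val-top = trans (val-0s∷ʳtrue (suc n)) (sym m≡)
                (ψ , ψ-iso , ψ-𝒜 , ψG≡top) = Generic.extends tame ¬Δa ¬Δ1 embed-isEmbedding (0s ∷ʳ true) val-top G-option
                                               Doubling.representatives in
            ψ , ψ-iso , ψ-𝒜 , (λ Δa → ⊥-elim (¬Δa Δa)) , (λ Δ1 → ⊥-elim (¬Δ1 Δ1)) , (λ _ _ → 0s ∷ʳ true , ψG≡top , val-top)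

lemma4p7 : (n : ℕ) → 2 ≤ n
    → (𝒜 : GameSet) → Closed 𝒜
    → (φ : Game → 𝒯 n) → IsQuotientIso 𝒜 φ
    → Faithful 𝒜 φ
    → (∀ {X} i → 𝒜 X → φ X ≡ z i → grundy X ≡ val i)
    → (G : Game) → G ≢ 𝟘
    → (∀ {G′} → G′ isOptionOf G → 𝒜 G′)
    → Tame φ G
    → let m = grundy G
          ℬ = cl (λ X → 𝒜 X ⊎ X ≡ G)
      in (m < 2 ^ n
           → Σ (Game → 𝒯 n) λ ψ → IsQuotientIso ℬ ψ
               × (∀ {Y} → 𝒜 Y → ψ Y ≡ φ Y)
               × (Δ≐ φ G (a ∷ []) → ψ G ≡ one)
               × (Δ≐ φ G (one ∷ []) → ψ G ≡ a)
               × (¬ Δ≐ φ G (a ∷ []) → ¬ Δ≐ φ G (one ∷ [])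
                   → Σ (Bits n) λ i → ψ G ≡ z i × val i ≡ m))
       × (m ≡ 2 ^ n
           → Σ (Game → 𝒯 (suc n)) λ ψ → IsQuotientIso ℬ ψ
               × (∀ {Y} → 𝒜 Y → ψ Y ≡ embed (φ Y))
               × (Δ≐ φ G (a ∷ []) → ψ G ≡ one)
               × (Δ≐ φ G (one ∷ []) → ψ G ≡ a)
               × (¬ Δ≐ φ G (a ∷ []) → ¬ Δ≐ φ G (one ∷ [])
                   → Σ (Bits (suc n)) λ i → ψ G ≡ z i × val i ≡ m))
lemma4p7 zero ()
lemma4p7 (suc n) _ 𝒜 𝒜-closed φ φ-iso φ-faithful grundy-z G G≢𝟘 G-options tame = small , large
  where
  open Quotient.WithGame.Main 𝒜 𝒜-closed φ φ-iso φ-faithful grundy-z G G-options (≢𝟘⇒option G G≢𝟘) tame
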